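{- Let $C_{\mathrm{lat}}$ and $A$ be as in the context, and let $\Phi\colon C_{\mathrm{lat}}\to A$ be the linear map with $\Phi(\llbracket P,Q\rrbracket)=P/Q$. Then $\Phi$ is a coalgebra homomorphism from $(C_{\mathrm{lat}},\delta_{\mathrm{lat}},\varepsilon_{\mathrm{lat}})$ to $(A,\delta,\varepsilon_A)$.
   Context: $\mathbb K$ is a field of characteristic $0$. Noncrossing partitions (no $a,b$ in one block, $c,d$ in another with $a<c<b<d$) are identified with standard representatives on $[n]$; restrictions $P_{|X}$ are standardized. $\mathrm{NCP}(n)$: noncrossing partitions of $[n]$, ordered by $P\le Q$ iff each block of $Q$ is a union of blocks of $P$ (a lattice); $\mathrm{NCP}=\bigcup_{n\ge1}\mathrm{NCP}(n)$. For $P\le Q$ in $\mathrm{NCP}(n)$, $\llbracket P,Q\rrbracket=\{M: P\le M\le Q\}$ and $P/Q=\prod_{\tau\in Q}P_{|\tau}$. $C_{\mathrm{lat}}$ is the vector space with basis the intervals $\llbracket P,Q\rrbracket$ ($P\le Q$ in some $\mathrm{NCP}(n)$, $n\ge1$), with the (opposite incidence) coproduct $\delta_{\mathrm{lat}}(\llbracket P,Q\rrbracket)=\sum_{M\in\llbracket P,Q\rrbracket}\llbracket M,Q\rrbracket\otimes\llbracket P,M\rrbracket$ and counit $\varepsilon_{\mathrm{lat}}(\llbracket P,Q\rrbracket)=1$ if $P=Q$, $0$ otherwise. $A$ is the free commutative unital algebra on $\mathrm{NCP}$ with the algebra-morphism coproduct $\delta(P)=\sum_{Q\in\mathrm{NCP}(n),\,Q\ge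 P}Q\otimes P/Q$ for $P\in\mathrm{NCP}(n)$ and the algebra-morphism counit $\varepsilon_A(P)=1$ if $P$ has exactly one block, $0$ otherwise. -}

module Defs where

open import Level using (Level)
open import Data.Bool using (Bool; true; false; _∧_; _∨_; not; if_then_else_; T)
open import Data.Nat using (ℕ; zero; suc; _<ᵇ_; _≤ᵇ_; _⊔_) renaming (_≡ᵇ_ to _==_)
open import Data.List using (List; []; _∷_; _++_; map; concatMap; filter; foldr; length; upTo; zip; [_])
open import Data.List.Properties using (≡-dec)
open import Data.Maybe using (Maybe; just; nothing)
open import Data.Product using (Σ; _×_; _,_; proj₁; proj₂)
open import Data.Empty using (⊥)
open import Algebra.Bundles using (CommutativeRing)
open import Relation.Nullary using (Dec; yes; no; ¬_; does)
open import Relation.Nullary.Decidable using (T?)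
open import Relation.Binary.PropositionalEquality using (_≡_)
import Data.Nat as ℕ

natCast : {c ℓ : Level} (K : CommutativeRing c ℓ) → ℕ → CommutativeRing.Carrier K
natCast K zero    = CommutativeRing.0# K
natCast K (suc n) = CommutativeRing._+_ K (CommutativeRing.1# K) (natCast K n)

record IsFieldChar0 {c ℓ : Level} (K : CommutativeRing c ℓ) : Set (Level.suc (c Level.⊔ ℓ)) where
  open CommutativeRing K
  field
    nontrivial    : ¬ (1# ≈ 0#)
    inverses      : ∀ x → ¬ (x ≈ 0#) → Σ Carrier λ y → x * y ≈ 1#
    characteristic0 : ∀ (n : ℕ) → natCast K (suc n) ≈ 0# → ⊥

-- Set partitions of [n] as restricted growth strings (standard representatives):
-- a list p of length n, p_i = label of the block of i, blocks labelled by order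
-- of first appearance 0,1,2,...

all : {A : Set} → (A → Bool) → List A → Bool
all p []       = true
all p (x ∷ xs) = p x ∧ all p xs

_=L_ : List ℕ → List ℕ → Bool
l =L m = does (≡-dec ℕ._≟_ l m)

-- entry i (0-based), default 0
at : List ℕ → ℕ → ℕ
at []       _       = 0
at (x ∷ xs) zero    = x
at (x ∷ xs) (suc i) = at xs i

-- restricted growth: each label is at most (number of labels used so far)
rgsFrom : ℕ → List ℕ → Bool
rgsFrom k []       = true
rgsFrom k (x ∷ xs) = (x ≤ᵇ k) ∧ rgsFrom (k ⊔ suc x) xs

isRGS : List ℕ → Bool
isRGS = rgsFrom 0

nonempty : List ℕ → Bool
nonempty []      = false
nonempty (_ ∷ _) = true

isNoncrossing : List ℕ → Bool
isNoncrossing p =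
  all (λ a → all (λ c → all (λ b → all (λ d →
        not ((a <ᵇ c) ∧ (c <ᵇ b) ∧ (b <ᵇ d)
             ∧ (at p a == at p b) ∧ (at p c == at p d) ∧ not (at p a == at p c)))
      (upTo n)) (upTo n)) (upTo n)) (upTo n)
  where n = length p

isNCP : List ℕ → Bool
isNCP p = nonempty p ∧ isRGS p ∧ isNoncrossing p

NCP : Set
NCP = Σ (List ℕ) (λ p → T (isNCP p))

size : NCP → ℕ
size P = length (proj₁ P)

nblocks : List ℕ → ℕ
nblocks = foldr (λ x m → suc x ⊔ m) 0

leqL : List ℕ → List ℕ → Bool
leqL p q = (length p == length q) ∧
  all (λ i → all (λ j → not (at p i == at p j) ∨ (at q i == at q j))
    (upTo (length p))) (upTo (length p))

_≤P_ : NCP → NCP → Bool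
P ≤P Q = leqL (proj₁ P) (proj₁ Q)

_=P_ : NCP → NCP → Bool
P =P Q = proj₁ P =L proj₁ Q

words : ℕ → ℕ → List (List ℕ)
words zero    k = [ [] ]
words (suc n) k = concatMap (λ x → map (x ∷_) (words n k)) (upTo k)

toNCP? : List ℕ → Maybe NCP
toNCP? p with T? (isNCP p)
... | yes h = just (p , h)
... | no  _ = nothing

catMaybes : {A : Set} → List (Maybe A) → List A
catMaybes []             = []
catMaybes (just x ∷ xs)  = x ∷ catMaybes xs
catMaybes (nothing ∷ xs) = catMaybes xs

NCPs : ℕ → List NCP
NCPs n = catMaybes (map toNCP? (words n n))

indexOf : ℕ → List ℕ → Maybe ℕ
indexOf x []       = nothing
indexOf x (y ∷ ys) = if x == y then just 0 else Data.Maybe.map suc (indexOf x ys)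

stdFrom : List ℕ → List ℕ → List ℕ
stdFrom seen []       = []
stdFrom seen (x ∷ xs) with indexOf x seen
... | just i  = i ∷ stdFrom seen xs
... | nothing = length seen ∷ stdFrom (seen ++ [ x ]) xs

standardize : List ℕ → List ℕ
standardize = stdFrom []

-- P_{|τ} for τ the block of Q with label b (standardized)
restrictToBlock : List ℕ → List ℕ → ℕ → List ℕ
restrictToBlock p q b =
  standardize (map proj₁ (filter (λ pq → proj₂ pq ℕ.≟ b) (zip p q)))

-- a restriction of a noncrossing partition to a block is again one; the
-- fallback [0] below is never reached when P ≤ Q
asNCP : List ℕ → NCP
asNCP p with T? (isNCP p)
... | yes h = p , h
... | no  _ = (0 ∷ []) , _

-- Free modules: formal K-linear combinations of basis elements, with
-- equality = equality of all coefficients (w.r.t. a Bool-valued basis equality)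

module FreeModule {c ℓ : Level} (K : CommutativeRing c ℓ) where
  open CommutativeRing K

  LC : Set → Set c
  LC B = List (Carrier × B)

  coeff : {B : Set} → (B → B → Bool) → LC B → B → Carrier
  coeff eq v b = foldr (λ cb acc → if eq b (proj₂ cb) then proj₁ cb + acc else acc) 0# v

  EqLC : {B : Set} → (B → B → Bool) → LC B → LC B → Set ℓ
  EqLC eq v w = ∀ b → coeff eq v b ≈ coeff eq w b

  lin : {B B' : Set} → (B → LC B') → LC B → LC B'
  lin f v = concatMap (λ cb → map (λ db → (proj₁ cb * proj₁ db , proj₂ db)) (f (proj₂ cb))) v

  linK : {B : Set} → (B → Carrier) → LC B → Carrier
  linK f v = foldr (λ cb acc → proj₁ cb * f (proj₂ cb) + acc) 0# v

  basis : {B : Set} → B → LC B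
  basis b = [ (1# , b) ]

  -- A = K[x_P : P ∈ NCP]: basis = monomials = finite multisets of NCPs,
  -- represented by lists, compared up to reordering (multiplicities)

  Mon : Set
  Mon = List NCP

  count : NCP → Mon → ℕ
  count P = foldr (λ Q n → if P =P Q then suc n else n) 0

  _=M_ : Mon → Mon → Bool
  m =M m' = all (λ P → count P m == count P m') (m ++ m')

  A : Set c
  A = LC Mon

  Mon² : Set
  Mon² = Mon × Mon

  _=M²_ : Mon² → Mon² → Bool
  x =M² y = (proj₁ x =M proj₁ y) ∧ (proj₂ x =M proj₂ y)

  A⊗A : Set c
  A⊗A = LC Mon²

  _≈A⊗A_ : A⊗A → A⊗A → Set ℓ
  _≈A⊗A_ = EqLC _=M²_

  one⊗ : A⊗A
  one⊗ = basis ([] , [])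

  mul⊗ : A⊗A → A⊗A → A⊗A
  mul⊗ v w = concatMap (λ x → map (λ y →
    (proj₁ x * proj₁ y , (proj₁ (proj₂ x) ++ proj₁ (proj₂ y) , proj₂ (proj₂ x) ++ proj₂ (proj₂ y)))) w) v

  -- P/Q = ∏_{τ ∈ Q} P_{|τ} (a monomial of A)
  quot : NCP → NCP → Mon
  quot P Q = map (λ b → asNCP (restrictToBlock (proj₁ P) (proj₁ Q) b)) (upTo (nblocks (proj₁ Q)))

  δgen : NCP → A⊗A
  δgen P = concatMap (λ Q → if P ≤P Q then basis ([ Q ] , quot P Q) else []) (NCPs (size P))

  δmon : Mon → A⊗A
  δmon = foldr (λ P acc → mul⊗ (δgen P) acc) one⊗

  δA : A → A⊗A
  δA = lin δmon

  εgen : NCP → Carrier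
  εgen P = if nblocks (proj₁ P) == 1 then 1# else 0#

  εmon : Mon → Carrier
  εmon = foldr (λ P acc → εgen P * acc) 1#

  εA : A → Carrier
  εA = linK εmon

  record Interval : Set where
    constructor ⟦_,_⟧⟨_⟩
    field
      lo hi : NCP
      lo≤hi : T (lo ≤P hi)

  _=I_ : Interval → Interval → Bool
  I =I J = (Interval.lo I =P Interval.lo J) ∧ (Interval.hi I =P Interval.hi J)

  Clat : Set c
  Clat = LC Interval

  Interval² : Set
  Interval² = Interval × Interval

  mkInterval : NCP → NCP → Maybe Interval
  mkInterval P Q with T? (P ≤P Q)
  ... | yes h = just ⟦ P , Q ⟧⟨ h ⟩
  ... | no  _ = nothing

  δlatTerm : NCP → NCP → NCP → LC Interval²
  δlatTerm P Q M with mkInterval M Q | mkInterval P M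
  ... | just I | just J = basis (I , J)
  ... | _      | _      = []

  δlatBasis : Interval → LC Interval²
  δlatBasis ⟦ P , Q ⟧⟨ _ ⟩ = concatMap (δlatTerm P Q) (NCPs (size P))

  δlat : Clat → LC Interval²
  δlat = lin δlatBasis

  εlatBasis : Interval → Carrier
  εlatBasis I = if Interval.lo I =P Interval.hi I then 1# else 0#

  εlat : Clat → Carrier
  εlat = linK εlatBasis

  Φ : Clat → A
  Φ = lin (λ I → basis (quot (Interval.lo I) (Interval.hi I)))

  Φ⊗Φ : LC Interval² → A⊗A
  Φ⊗Φ = lin (λ IJ → basis (quot (Interval.lo (proj₁ IJ)) (Interval.hi (proj₁ IJ)) ,
                             quot (Interval.lo (proj₂ IJ)) (Interval.hi (proj₂ IJ))))

  IsCoalgebraHom : Set (c Level.⊔ ℓ)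
  IsCoalgebraHom =
    (∀ (x : Clat) → Φ⊗Φ (δlat x) ≈A⊗A δA (Φ x)) × (∀ (x : Clat) → εA (Φ x) ≈ εlat x)

module Submission where

-- Fix P ≤ Q in NCP(n). Restriction to the blocks τ of Q is a bijection M ↦ (M|τ)_τ from the
-- interval [P, Q] onto the tuples (Z_τ)_τ with Z_τ ≥ P|τ: the inverse glues the Z_τ together,
-- and the result is noncrossing because Q is. For such M the blocks of M are the blocks of the
-- M|τ, so P/M = ∏_τ (P|τ)/(M|τ) as multisets. Hence
--   δ(P/Q) = ∏_τ δ(P|τ) = Σ_(Z_τ) ∏_τ Z_τ ⊗ ∏_τ (P|τ)/Z_τ = Σ_{M ∈ [P,Q]} M/Q ⊗ P/M = (Φ ⊗ Φ)(δ_lat ⟦P,Q⟧).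
-- For the counits: every P|τ has a single block exactly when P = Q.

open import Defs
open import Level using (Level; Lift; lift)
open import Algebra.Bundles using (CommutativeRing)
open import Data.Bool using (Bool; true; false; _∧_; _∨_; not; if_then_else_; T)
open import Data.Bool.Properties using (T-irrelevant)
open import Data.Empty using (⊥; ⊥-elim)
open import Data.List using (List; []; _∷_; _++_; map; concat; concatMap; filter; length; upTo; zip; [_]; applyUpTo)
open import Data.List.Properties
  using (map-applyUpTo; ∷-injective; length-++; upTo-∷ʳ; length-upTo; length-map; map-cong-local; map-++; map-∘;
         map-concatMap; concatMap-++; ++-identityʳ; ≡-dec)
open import Data.List.Membership.Propositional using (_∈_; find)
open import Data.List.Membership.Propositional.Properties
  using (∈-upTo⁺; ∈-upTo⁻; ∈-map⁺; ∈-map⁻; ∈-concatMap⁺; ∈-concatMap⁻; ∈-++⁻; ∈-++⁺ˡ; ∈-++⁺ʳ)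
open import Data.List.Membership.Propositional.Properties.WithK using (unique∧set⇒bag)
import Data.List.Membership.DecPropositional as DecMembership
open import Data.List.Relation.Unary.Any using (here; there)
import Data.List.Relation.Unary.Any as Any
import Data.List.Relation.Unary.All as All
import Data.List.Relation.Unary.AllPairs as AP
open import Data.List.Relation.Unary.Unique.Propositional using (Unique)
open import Data.List.Relation.Unary.Unique.Propositional.Properties using (++⁺; upTo⁺) renaming (map⁺ to Unique-map⁺)
open import Data.List.Relation.Binary.Disjoint.Propositional using (Disjoint)
open import Data.List.Relation.Binary.Permutation.Propositional using (_↭_)
import Data.List.Relation.Binary.Permutation.Propositional as ↭
import Data.List.Relation.Binary.Permutation.Propositional.Properties as ↭
open import Data.List.Relation.Binary.BagAndSetEquality using (∼bag⇒↭)
open import Data.Maybe using (Maybe; just; nothing; fromMaybe)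
open import Data.Nat using (ℕ; zero; suc) renaming (_≡ᵇ_ to _==_)
open import Data.Product using (Σ; _×_; _,_; proj₁; proj₂)
open import Data.Sum using (_⊎_; inj₁; inj₂)
open import Data.Unit using (⊤; tt)
open import Function.Base using (_∘_; case_of_)
open import Function.Bundles using (mk⇔)
open import Relation.Binary using (tri<; tri≈; tri>)
open import Relation.Binary.Definitions using (DecidableEquality)
open import Relation.Binary.PropositionalEquality hiding ([_])
open import Relation.Nullary using (¬_; yes; no; Dec)
open import Relation.Nullary.Decidable using (T?)

module Partitions where

  open import Data.Nat using (_<_; _≤_; z≤n; s≤s; _<ᵇ_; _≤ᵇ_; _⊔_; _+_; _*_)
  import Data.Nat as ℕ
  open import Data.Nat.Properties

  -- Logical equivalence as a plain pair of maps, so that it can be taken apart by pattern lets.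
  infix 2 _⇔_
  _⇔_ : Set → Set → Set
  A ⇔ B = (A → B) × (B → A)

  ⇔-trans : ∀ {A B C} → A ⇔ B → B ⇔ C → A ⇔ C
  ⇔-trans (f , g) (f′ , g′) = (λ a → f′ (f a)) , (λ c → g (g′ c))

  T-∧⁻ : ∀ {a b} → T (a ∧ b) → T a × T b
  T-∧⁻ {true} {true} _ = tt , tt

  T-∧⁺ : ∀ {a b} → T a → T b → T (a ∧ b)
  T-∧⁺ {true} {true} _ _ = tt

  T-not⁻ : ∀ {a} → T (not a) → ¬ T a
  T-not⁻ {false} _ ()

  T-not⁺ : ∀ {a} → ¬ T a → T (not a)
  T-not⁺ {false} _ = tt
  T-not⁺ {true} h = h tt

  T-∨⁻ : ∀ {a b} → T (a ∨ b) → T a ⊎ T b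
  T-∨⁻ {true} _ = inj₁ tt
  T-∨⁻ {false} {true} _ = inj₂ tt

  T-∨⁺ˡ : ∀ {a b} → T a → T (a ∨ b)
  T-∨⁺ˡ {true} _ = tt

  T-∨⁺ʳ : ∀ {a b} → T b → T (a ∨ b)
  T-∨⁺ʳ {true} _ = tt
  T-∨⁺ʳ {false} h = h

  T-injective : ∀ {a b} → (T a → T b) → (T b → T a) → a ≡ b
  T-injective {true} {true} _ _ = refl
  T-injective {true} {false} f _ = ⊥-elim (f tt)
  T-injective {false} {true} _ g = ⊥-elim (g tt)
  T-injective {false} {false} _ _ = refl

  T→true : ∀ {b} → T b → b ≡ true
  T→true {true} _ = refl

  ¬T→false : ∀ {b} → ¬ T b → b ≡ false
  ¬T→false {true} h = ⊥-elim (h tt)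
  ¬T→false {false} h = refl

  ==→≡ : ∀ {m n} → T (m == n) → m ≡ n
  ==→≡ {m} {n} = ≡ᵇ⇒≡ m n

  ≡→== : ∀ {m n} → m ≡ n → T (m == n)
  ≡→== {m} {n} = ≡⇒≡ᵇ m n

  T-all⁻ : ∀ {A : Set} (f : A → Bool) {xs x} → T (all f xs) → x ∈ xs → T (f x)
  T-all⁻ f {y ∷ xs} h (here refl) = proj₁ (T-∧⁻ {f y} h)
  T-all⁻ f {y ∷ xs} h (there m) = T-all⁻ f (proj₂ (T-∧⁻ {f y} h)) m

  T-all⁺ : ∀ {A : Set} (f : A → Bool) xs → (∀ {x} → x ∈ xs → T (f x)) → T (all f xs)
  T-all⁺ f [] h = tt
  T-all⁺ f (x ∷ xs) h = T-∧⁺ (h (here refl)) (T-all⁺ f xs (λ m → h (there m)))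

  T-all-upTo⁻ : ∀ (f : ℕ → Bool) n → T (all f (upTo n)) → ∀ i → i < n → T (f i)
  T-all-upTo⁻ f n h i i<n = T-all⁻ f h (∈-upTo⁺ i<n)

  T-all-upTo⁺ : ∀ (f : ℕ → Bool) n → (∀ i → i < n → T (f i)) → T (all f (upTo n))
  T-all-upTo⁺ f n h = T-all⁺ f (upTo n) (λ m → h _ (∈-upTo⁻ m))

  all-false : ∀ {A : Set} (f : A → Bool) xs → ¬ T (all f xs) → Σ A λ x → (x ∈ xs) × ¬ T (f x)
  all-false f [] h = ⊥-elim (h tt)
  all-false f (x ∷ xs) h with f x in e
  ... | false = x , here refl , λ t → subst T e t
  ... | true = let (y , m , h′) = all-false f xs h in y , there m , h′

  -- Standardization

  at-++ˡ : ∀ (s t : List ℕ) i → i < length s → at (s ++ t) i ≡ at s i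
  at-++ˡ (x ∷ s) t zero _ = refl
  at-++ˡ (x ∷ s) t (suc i) (s≤s h) = at-++ˡ s t i h

  at-++ʳ : ∀ (s t : List ℕ) i → at (s ++ t) (length s + i) ≡ at t i
  at-++ʳ [] t i = refl
  at-++ʳ (x ∷ s) t i = at-++ʳ s t i

  at-snoc : ∀ (s : List ℕ) x → at (s ++ [ x ]) (length s) ≡ x
  at-snoc s x = trans (cong (at (s ++ [ x ])) (sym (+-identityʳ (length s)))) (at-++ʳ s [ x ] 0)

  length-snoc : ∀ (s : List ℕ) x → length (s ++ [ x ]) ≡ suc (length s)
  length-snoc s x = trans (length-++ s) (+-comm (length s) 1)

  at-map : ∀ (f : ℕ → ℕ) l u → u < length l → at (map f l) u ≡ f (at l u)
  at-map f (x ∷ l) zero _ = refl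
  at-map f (x ∷ l) (suc u) (s≤s h) = at-map f l u h

  at-applyUpTo : ∀ (f : ℕ → ℕ) n i → i < n → at (applyUpTo f n) i ≡ f i
  at-applyUpTo f (suc n) zero _ = refl
  at-applyUpTo f (suc n) (suc i) (s≤s h) = at-applyUpTo (λ k → f (suc k)) n i h

  at-upTo : ∀ n i → i < n → at (upTo n) i ≡ i
  at-upTo n i h = at-applyUpTo (λ k → k) n i h

  indexOf-just⁻ : ∀ x s k → indexOf x s ≡ just k → (at s k ≡ x) × (k < length s)
  indexOf-just⁻ x (y ∷ s) k e with x == y in eq
  indexOf-just⁻ x (y ∷ s) k refl | true = sym (==→≡ (subst T (sym eq) tt)) , s≤s z≤n
  ... | false with indexOf x s in e′
  indexOf-just⁻ x (y ∷ s) k refl | false | just k′ =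
    let (a , b) = indexOf-just⁻ x s k′ e′ in a , s≤s b

  indexOf-just-first : ∀ x s {k} → indexOf x s ≡ just k → ∀ k′ → k′ < k → at s k′ ≢ x
  indexOf-just-first x (y ∷ s) e k′ k′<k with x == y in eq
  indexOf-just-first x (y ∷ s) refl k′ () | true
  ... | false with indexOf x s in e′
  indexOf-just-first x (y ∷ s) refl zero k′<k | false | just _ = λ y≡x → subst T eq (≡→== (sym y≡x))
  indexOf-just-first x (y ∷ s) refl (suc k′) (s≤s k′<k) | false | just _ = indexOf-just-first x s e′ k′ k′<k

  indexOf-nothing⁻ : ∀ x s → indexOf x s ≡ nothing → ∀ k → k < length s → at s k ≢ x
  indexOf-nothing⁻ x (y ∷ s) e k h with x == y in eq
  indexOf-nothing⁻ x (y ∷ s) () k h | true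
  ... | false with indexOf x s in e′
  indexOf-nothing⁻ x (y ∷ s) refl zero h | false | nothing = λ y≡x → subst T eq (≡→== (sym y≡x))
  indexOf-nothing⁻ x (y ∷ s) refl (suc k) (s≤s h) | false | nothing = indexOf-nothing⁻ x s e′ k h

  indexOf-just⁺ : ∀ x s k → k < length s → at s k ≡ x → (∀ k′ → k′ < k → at s k′ ≢ x) →
    indexOf x s ≡ just k
  indexOf-just⁺ x (y ∷ s) zero h a f with x == y in eq
  ... | true = refl
  ... | false = ⊥-elim (subst T eq (≡→== (sym a)))
  indexOf-just⁺ x (y ∷ s) (suc k) (s≤s h) a f with x == y in eq
  ... | true = ⊥-elim (f zero (s≤s z≤n) (sym (==→≡ (subst T (sym eq) tt))))
  ... | false rewrite indexOf-just⁺ x s k h a (λ k′ k′<k → f (suc k′) (s≤s k′<k)) = refl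

  indexOf-nothing⁺ : ∀ x s → (∀ k → k < length s → at s k ≢ x) → indexOf x s ≡ nothing
  indexOf-nothing⁺ x [] f = refl
  indexOf-nothing⁺ x (y ∷ s) f with x == y in eq
  ... | true = ⊥-elim (f zero (s≤s z≤n) (sym (==→≡ (subst T (sym eq) tt))))
  ... | false rewrite indexOf-nothing⁺ x s (λ k h → f (suc k) (s≤s h)) = refl

  indexOf-occurs : ∀ x s j → j < length s → at s j ≡ x → Σ ℕ λ j₀ → indexOf x s ≡ just j₀
  indexOf-occurs x s j h e with indexOf x s in eq
  ... | just j₀ = j₀ , refl
  ... | nothing = ⊥-elim (indexOf-nothing⁻ x s eq j h e)

  indexOf-cong : ∀ x s y s′ → length s ≡ length s′ →
    (∀ k → k < length s → (at s k ≡ x) ⇔ (at s′ k ≡ y)) → indexOf x s ≡ indexOf y s′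
  indexOf-cong x s y s′ ls corr with indexOf x s in e
  ... | just k =
    let (a , h) = indexOf-just⁻ x s k e in
    sym (indexOf-just⁺ y s′ k (subst (k <_) ls h) (proj₁ (corr k h) a)
      (λ k′ k′<k b → indexOf-just-first x s e k′ k′<k (proj₂ (corr k′ (<-trans k′<k h)) b)))
  ... | nothing = sym (indexOf-nothing⁺ y s′ λ k hk b →
    let hk′ = subst (k <_) (sym ls) hk in indexOf-nothing⁻ x s e k hk′ (proj₂ (corr k hk′) b))

  indexOf-++-just : ∀ x s t k → indexOf x s ≡ just k → indexOf x (s ++ t) ≡ just k
  indexOf-++-just x s t k e =
    let (a , h) = indexOf-just⁻ x s k e in
    indexOf-just⁺ x (s ++ t) k (<-≤-trans h (≤-trans (m≤m+n (length s) (length t)) (≤-reflexive (sym (length-++ s)))))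
      (trans (at-++ˡ s t k h) a)
      (λ k′ k′<k → subst (_≢ x) (sym (at-++ˡ s t k′ (<-trans k′<k h))) (indexOf-just-first x s e k′ k′<k))

  indexOf-snoc-self : ∀ x s → indexOf x s ≡ nothing → indexOf x (s ++ [ x ]) ≡ just (length s)
  indexOf-snoc-self x s e =
    indexOf-just⁺ x (s ++ [ x ]) (length s) (≤-reflexive (sym (length-snoc s x))) (at-snoc s x)
      (λ k′ k′<k → subst (_≢ x) (sym (at-++ˡ s [ x ] k′ k′<k)) (indexOf-nothing⁻ x s e k′ k′<k))

  indexOf-snoc-other : ∀ x y s → indexOf x s ≡ nothing → x ≢ y → indexOf x (s ++ [ y ]) ≡ nothing
  indexOf-snoc-other x y s e x≢y = indexOf-nothing⁺ x (s ++ [ y ]) absent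
    where
    absent : ∀ k → k < length (s ++ [ y ]) → at (s ++ [ y ]) k ≢ x
    absent k h with <-cmp k (length s)
    ... | tri< k<l _ _ = subst (_≢ x) (sym (at-++ˡ s [ y ] k k<l)) (indexOf-nothing⁻ x s e k k<l)
    ... | tri≈ _ refl _ = λ a → x≢y (trans (sym a) (at-snoc s y))
    ... | tri> _ _ k>l = ⊥-elim (<⇒≱ h (subst (_≤ k) (sym (length-snoc s y)) k>l))

  indexOf-upTo : ∀ n x → x < n → indexOf x (upTo n) ≡ just x
  indexOf-upTo n x h = indexOf-just⁺ x (upTo n) x (subst (x <_) (sym (length-upTo n)) h) (at-upTo n x h)
    (λ k′ k′<k e → <-irrefl (trans (sym (at-upTo n k′ (<-trans k′<k h))) e) k′<k)

  indexOf-upTo-self : ∀ n → indexOf n (upTo n) ≡ nothing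
  indexOf-upTo-self n = indexOf-nothing⁺ n (upTo n) λ k h e →
    let h′ = subst (k <_) (length-upTo n) h in <-irrefl (trans (sym (at-upTo n k h′)) e) h′

  length-stdFrom : ∀ s xs → length (stdFrom s xs) ≡ length xs
  length-stdFrom s [] = refl
  length-stdFrom s (x ∷ xs) with indexOf x s
  ... | just i = cong suc (length-stdFrom s xs)
  ... | nothing = cong suc (length-stdFrom (s ++ [ x ]) xs)

  stdFrom-isRGS : ∀ s xs → T (rgsFrom (length s) (stdFrom s xs))
  stdFrom-isRGS s [] = tt
  stdFrom-isRGS s (x ∷ xs) with indexOf x s in e
  ... | just i = let (_ , h) = indexOf-just⁻ x s i e in
    T-∧⁺ (≤⇒≤ᵇ (<⇒≤ h)) (subst (λ k → T (rgsFrom k (stdFrom s xs))) (sym (m≥n⇒m⊔n≡m h)) (stdFrom-isRGS s xs))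
  ... | nothing = T-∧⁺ (≤⇒≤ᵇ (≤-refl {length s}))
    (subst (λ k → T (rgsFrom k (stdFrom (s ++ [ x ]) xs)))
      (trans (length-snoc s x) (sym (m≤n⇒m⊔n≡n (n≤1+n (length s))))) (stdFrom-isRGS (s ++ [ x ]) xs))

  standardize-isRGS : ∀ p → T (isRGS (standardize p))
  standardize-isRGS p = stdFrom-isRGS [] p

  at-stdFrom-seen : ∀ s xs j k → j < length xs → indexOf (at xs j) s ≡ just k → at (stdFrom s xs) j ≡ k
  at-stdFrom-seen s (x ∷ xs) zero k _ e with indexOf x s
  at-stdFrom-seen s (x ∷ xs) zero k _ refl | just _ = refl
  at-stdFrom-seen s (x ∷ xs) (suc j) k (s≤s h) e with indexOf x s
  ... | just _ = at-stdFrom-seen s xs j k h e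
  ... | nothing = at-stdFrom-seen (s ++ [ x ]) xs j k h (indexOf-++-just (at xs j) s [ x ] k e)

  at-stdFrom-unseen : ∀ s xs j → j < length xs → indexOf (at xs j) s ≡ nothing → length s ≤ at (stdFrom s xs) j
  at-stdFrom-unseen s (x ∷ xs) zero _ e with indexOf x s
  at-stdFrom-unseen s (x ∷ xs) zero _ () | just _
  ... | nothing = ≤-refl
  at-stdFrom-unseen s (x ∷ xs) (suc j) (s≤s h) e with indexOf x s
  ... | just _ = at-stdFrom-unseen s xs j h e
  ... | nothing with at xs j ≟ x
  ...   | yes refl = ≤-reflexive (sym (at-stdFrom-seen (s ++ [ x ]) xs j (length s) h (indexOf-snoc-self x s e)))
  ...   | no ne = ≤-trans (n≤1+n (length s)) (subst (_≤ at (stdFrom (s ++ [ x ]) xs) j) (length-snoc s x)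
                    (at-stdFrom-unseen (s ++ [ x ]) xs j h (indexOf-snoc-other (at xs j) x s e ne)))

  SameKernel : ℕ → List ℕ → List ℕ → Set
  SameKernel n p p′ = ∀ i j → i < n → j < n → (at p i ≡ at p j) ⇔ (at p′ i ≡ at p′ j)

  stdFrom-kernel-head : ∀ s x xs j → j < length xs →
    (at (stdFrom s (x ∷ xs)) 0 ≡ at (stdFrom s (x ∷ xs)) (suc j)) ⇔ (x ≡ at xs j)
  stdFrom-kernel-head s x xs j h with indexOf x s in e
  ... | just k = to , from
    where
    to : k ≡ at (stdFrom s xs) j → x ≡ at xs j
    to eq with indexOf (at xs j) s in e′
    ... | just k′ = trans (sym (proj₁ (indexOf-just⁻ x s k e)))
                     (trans (cong (at s) (trans eq (at-stdFrom-seen s xs j k′ h e′))) (proj₁ (indexOf-just⁻ (at xs j) s k′ e′)))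
    ... | nothing = ⊥-elim (<⇒≱ (proj₂ (indexOf-just⁻ x s k e)) (subst (length s ≤_) (sym eq) (at-stdFrom-unseen s xs j h e′)))
    from : x ≡ at xs j → k ≡ at (stdFrom s xs) j
    from refl = sym (at-stdFrom-seen s xs j k h e)
  ... | nothing = to , from
    where
    s′ = s ++ [ x ]
    to : length s ≡ at (stdFrom s′ xs) j → x ≡ at xs j
    to eq with indexOf (at xs j) s′ in e′
    ... | just k′ = trans (sym (at-snoc s x))
                      (trans (cong (at s′) (trans eq (at-stdFrom-seen s′ xs j k′ h e′))) (proj₁ (indexOf-just⁻ (at xs j) s′ k′ e′)))
    ... | nothing = ⊥-elim (<⇒≱ (n<1+n (length s)) (subst₂ _≤_ (length-snoc s x) (sym eq) (at-stdFrom-unseen s′ xs j h e′)))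
    from : x ≡ at xs j → length s ≡ at (stdFrom s′ xs) j
    from refl = sym (at-stdFrom-seen s′ xs j (length s) h (indexOf-snoc-self x s e))

  stdFrom-kernel : ∀ s xs → SameKernel (length xs) (stdFrom s xs) xs
  stdFrom-kernel s (x ∷ xs) zero zero _ _ = (λ _ → refl) , (λ _ → refl)
  stdFrom-kernel s (x ∷ xs) zero (suc j) _ (s≤s h) = stdFrom-kernel-head s x xs j h
  stdFrom-kernel s (x ∷ xs) (suc i) zero (s≤s h) _ =
    let (to , from) = stdFrom-kernel-head s x xs i h in (λ e → sym (to (sym e))) , (λ e → sym (from (sym e)))
  stdFrom-kernel s (x ∷ xs) (suc i) (suc j) (s≤s hi) (s≤s hj) with indexOf x s
  ... | just _ = stdFrom-kernel s xs i j hi hj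
  ... | nothing = stdFrom-kernel (s ++ [ x ]) xs i j hi hj

  -- Generalised for the induction: the already-seen lists s, s′ must relate to xs, ys in the same way.
  stdFrom-cong : ∀ s s′ xs ys → length s ≡ length s′ → length xs ≡ length ys →
    (∀ k j → k < length s → j < length xs → (at s k ≡ at xs j) ⇔ (at s′ k ≡ at ys j)) →
    SameKernel (length xs) xs ys → stdFrom s xs ≡ stdFrom s′ ys
  stdFrom-cong s s′ [] [] ls lx corr ker = refl
  stdFrom-cong s s′ (x ∷ xs) (y ∷ ys) ls lx corr ker
    with indexOf x s | indexOf y s′ | indexOf-cong x s y s′ ls (λ k hk → corr k 0 hk (s≤s z≤n))
  ... | just k | .(just k) | refl = cong (k ∷_) (stdFrom-cong s s′ xs ys ls lx′ corrTail kerTail)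
    where
    lx′ = suc-injective lx
    corrTail : ∀ k j → k < length s → j < length xs → (at s k ≡ at xs j) ⇔ (at s′ k ≡ at ys j)
    corrTail k j hk hj = corr k (suc j) hk (s≤s hj)
    kerTail : SameKernel (length xs) xs ys
    kerTail i j hi hj = ker (suc i) (suc j) (s≤s hi) (s≤s hj)
  ... | nothing | .nothing | refl =
    cong₂ _∷_ ls (stdFrom-cong (s ++ [ x ]) (s′ ++ [ y ]) xs ys
      (trans (length-snoc s x) (trans (cong suc ls) (sym (length-snoc s′ y)))) lx′ corrSnoc kerTail)
    where
    lx′ = suc-injective lx
    kerTail : SameKernel (length xs) xs ys
    kerTail i j hi hj = ker (suc i) (suc j) (s≤s hi) (s≤s hj)
    corrSnoc : ∀ k j → k < length (s ++ [ x ]) → j < length xs →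
      (at (s ++ [ x ]) k ≡ at xs j) ⇔ (at (s′ ++ [ y ]) k ≡ at ys j)
    corrSnoc k j hk hj with <-cmp k (length s)
    ... | tri< k<l _ _ =
      subst₂ (λ u v → (u ≡ at xs j) ⇔ (v ≡ at ys j)) (sym (at-++ˡ s [ x ] k k<l))
        (sym (at-++ˡ s′ [ y ] k (subst (k <_) ls k<l))) (corr k (suc j) k<l (s≤s hj))
    ... | tri≈ _ refl _ =
      subst₂ (λ u v → (u ≡ at xs j) ⇔ (v ≡ at ys j)) (sym (at-snoc s x))
        (sym (trans (cong (at (s′ ++ [ y ])) ls) (at-snoc s′ y))) (ker 0 (suc j) (s≤s z≤n) (s≤s hj))
    ... | tri> _ _ k>l = ⊥-elim (<⇒≱ hk (subst (_≤ k) (sym (length-snoc s x)) k>l))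

  standardize-cong : ∀ p p′ → length p ≡ length p′ → SameKernel (length p) p p′ → standardize p ≡ standardize p′
  standardize-cong p p′ l ker = stdFrom-cong [] [] p p′ refl l (λ k j ()) ker

  stdFrom-upTo-isRGS : ∀ k xs → T (rgsFrom k xs) → stdFrom (upTo k) xs ≡ xs
  stdFrom-upTo-isRGS k [] _ = refl
  stdFrom-upTo-isRGS k (x ∷ xs) h with T-∧⁻ {x ≤ᵇ k} h
  ... | (a , b) with m≤n⇒m<n∨m≡n (≤ᵇ⇒≤ x k a)
  ...   | inj₁ x<k rewrite indexOf-upTo k x x<k =
          cong (x ∷_) (stdFrom-upTo-isRGS k xs (subst (λ z → T (rgsFrom z xs)) (m≥n⇒m⊔n≡m x<k) b))
  ...   | inj₂ refl rewrite indexOf-upTo-self x | upTo-∷ʳ x | length-upTo x =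
          cong (x ∷_) (stdFrom-upTo-isRGS (suc x) xs (subst (λ z → T (rgsFrom z xs)) (m≤n⇒m⊔n≡n (n≤1+n x)) b))

  standardize-isRGS-id : ∀ p → T (isRGS p) → standardize p ≡ p
  standardize-isRGS-id p h = stdFrom-upTo-isRGS 0 p h

  isRGS-kernel-unique : ∀ p p′ → T (isRGS p) → T (isRGS p′) → length p ≡ length p′ →
    SameKernel (length p) p p′ → p ≡ p′
  isRGS-kernel-unique p p′ h h′ l ker = begin
    p              ≡⟨ standardize-isRGS-id p h ⟨
    standardize p  ≡⟨ standardize-cong p p′ l ker ⟩
    standardize p′ ≡⟨ standardize-isRGS-id p′ h′ ⟩
    p′             ∎
    where open ≡-Reasoning

  -- Noncrossing partitions and their enumeration

  NCP-≡ : ∀ {P P′ : NCP} → proj₁ P ≡ proj₁ P′ → P ≡ P′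
  NCP-≡ {p , h} {.p , h′} refl = cong (p ,_) (T-irrelevant h h′)

  =P→≡ : ∀ (P Q : NCP) → T (P =P Q) → P ≡ Q
  =P→≡ P Q h with ≡-dec ℕ._≟_ (proj₁ P) (proj₁ Q)
  ... | yes e = NCP-≡ e

  ≡→=P : ∀ (P Q : NCP) → P ≡ Q → T (P =P Q)
  ≡→=P P Q e with ≡-dec ℕ._≟_ (proj₁ P) (proj₁ Q)
  ... | yes _ = tt
  ... | no ne = ne (cong proj₁ e)

  NCP-isRGS : (P : NCP) → T (isRGS (proj₁ P))
  NCP-isRGS (p , h) = proj₁ (T-∧⁻ {isRGS p} (proj₂ (T-∧⁻ {nonempty p} h)))

  NCP-isNoncrossing : (P : NCP) → T (isNoncrossing (proj₁ P))
  NCP-isNoncrossing (p , h) = proj₂ (T-∧⁻ {isRGS p} (proj₂ (T-∧⁻ {nonempty p} h)))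

  NCP-nonempty : (P : NCP) → T (nonempty (proj₁ P))
  NCP-nonempty (p , h) = proj₁ (T-∧⁻ {nonempty p} h)

  isNCP⁺ : ∀ p → T (nonempty p) → T (isRGS p) → T (isNoncrossing p) → T (isNCP p)
  isNCP⁺ p a b c = T-∧⁺ a (T-∧⁺ b c)

  nonempty⁺ : ∀ p → 0 < length p → T (nonempty p)
  nonempty⁺ (_ ∷ _) _ = tt

  nonempty⁻ : ∀ p → T (nonempty p) → 0 < length p
  nonempty⁻ (_ ∷ _) _ = s≤s z≤n

  rgsFrom-bound : ∀ k xs → T (rgsFrom k xs) → ∀ i → i < length xs → at xs i ≤ k + i
  rgsFrom-bound k (x ∷ xs) h zero _ = subst (x ≤_) (sym (+-identityʳ k)) (≤ᵇ⇒≤ x k (proj₁ (T-∧⁻ {x ≤ᵇ k} h)))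
  rgsFrom-bound k (x ∷ xs) h (suc i) (s≤s hi) = begin
    at xs i            ≤⟨ rgsFrom-bound (k ⊔ suc x) xs (proj₂ (T-∧⁻ {x ≤ᵇ k} h)) i hi ⟩
    (k ⊔ suc x) + i    ≤⟨ +-monoˡ-≤ i (⊔-lub (m≤m+n k 1) (subst (suc x ≤_) (+-comm 1 k) (s≤s x≤k))) ⟩
    (k + 1) + i        ≡⟨ +-assoc k 1 i ⟩
    k + suc i          ∎
    where
    open ≤-Reasoning
    x≤k = ≤ᵇ⇒≤ x k (proj₁ (T-∧⁻ {x ≤ᵇ k} h))

  isRGS-bound : ∀ p → T (isRGS p) → ∀ i → i < length p → at p i < length p
  isRGS-bound p h i hi = ≤-<-trans (rgsFrom-bound 0 p h i hi) hi

  at<nblocks : ∀ p i → i < length p → at p i < nblocks p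
  at<nblocks (x ∷ p) zero _ = m≤m⊔n (suc x) (nblocks p)
  at<nblocks (x ∷ p) (suc i) (s≤s h) = <-≤-trans (at<nblocks p i h) (m≤n⊔m (suc x) (nblocks p))

  rgsFrom-labels-occur : ∀ k xs → T (rgsFrom k xs) → ∀ b → k ≤ b → b < nblocks xs →
    Σ ℕ λ i → (i < length xs) × (at xs i ≡ b)
  rgsFrom-labels-occur k (x ∷ xs) h b k≤b b<nb with b ≟ x
  ... | yes refl = 0 , s≤s z≤n , refl
  ... | no b≢x =
    let (i , hi , e) = rgsFrom-labels-occur (k ⊔ suc x) xs (proj₂ (T-∧⁻ {x ≤ᵇ k} h)) b (⊔-lub k≤b x<b) b<nb′
    in suc i , s≤s hi , e
    where
    x<b : x < b
    x<b = ≤∧≢⇒< (≤-trans (≤ᵇ⇒≤ x k (proj₁ (T-∧⁻ {x ≤ᵇ k} h))) k≤b) (λ e → b≢x (sym e))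
    b<nb′ : b < nblocks xs
    b<nb′ with ⊔-sel (suc x) (nblocks xs)
    ... | inj₁ e = ⊥-elim (<-irrefl refl (<-≤-trans (subst (b <_) e b<nb) x<b))
    ... | inj₂ e = subst (b <_) e b<nb

  isRGS-labels-occur : ∀ p → T (isRGS p) → ∀ b → b < nblocks p → Σ ℕ λ i → (i < length p) × (at p i ≡ b)
  isRGS-labels-occur p h b b<nb = rgsFrom-labels-occur 0 p h b z≤n b<nb

  consAll : {A : Set} → List A → List (List A) → List (List A)
  consAll xs ys = concatMap (λ x → map (x ∷_) ys) xs

  ∈-consAll⁻ : ∀ {A : Set} {z : List A} xs ys → z ∈ consAll xs ys →
    Σ A λ x → Σ (List A) λ t → (z ≡ x ∷ t) × (x ∈ xs) × (t ∈ ys)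
  ∈-consAll⁻ (x ∷ xs) ys m with ∈-++⁻ (map (x ∷_) ys) m
  ... | inj₁ m′ = let (t , t∈ys , e) = ∈-map⁻ (x ∷_) m′ in x , t , e , here refl , t∈ys
  ... | inj₂ m′ = let (x′ , t , e , a , b) = ∈-consAll⁻ xs ys m′ in x′ , t , e , there a , b

  ∈-consAll⁺ : ∀ {A : Set} {x : A} {t} xs ys → x ∈ xs → t ∈ ys → (x ∷ t) ∈ consAll xs ys
  ∈-consAll⁺ {x = x} xs ys x∈xs t∈ys =
    ∈-concatMap⁺ (λ x → map (x ∷_) ys) (Any.map (λ { refl → ∈-map⁺ (x ∷_) t∈ys }) x∈xs)

  consAll-Unique : ∀ {A : Set} (xs : List A) (ys : List (List A)) → Unique xs → Unique ys → Unique (consAll xs ys)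
  consAll-Unique [] ys ux uy = AP.[]
  consAll-Unique (x ∷ xs) ys (x∉xs AP.∷ ux) uy =
    ++⁺ (Unique-map⁺ (λ e → proj₂ (∷-injective e)) uy) (consAll-Unique xs ys ux uy) disjoint
    where
    disjoint : Disjoint (map (x ∷_) ys) (consAll xs ys)
    disjoint (m₁ , m₂) with ∈-map⁻ (x ∷_) m₁ | ∈-consAll⁻ xs ys m₂
    ... | (t , _ , refl) | (x′ , t′ , e , x′∈xs , _) = All.lookup x∉xs x′∈xs (proj₁ (∷-injective e))

  ∈-words⁻ : ∀ n k p → p ∈ words n k → length p ≡ n
  ∈-words⁻ zero k .[] (here refl) = refl
  ∈-words⁻ (suc n) k p m with ∈-consAll⁻ (upTo k) (words n k) m
  ... | (x , t , refl , _ , mt) = cong suc (∈-words⁻ n k t mt)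

  ∈-words⁺ : ∀ n k p → length p ≡ n → (∀ i → i < length p → at p i < k) → p ∈ words n k
  ∈-words⁺ zero k [] _ _ = here refl
  ∈-words⁺ (suc n) k (x ∷ p) l h =
    ∈-consAll⁺ (upTo k) (words n k) (∈-upTo⁺ (h 0 (s≤s z≤n)))
      (∈-words⁺ n k p (suc-injective l) (λ i hi → h (suc i) (s≤s hi)))

  words-Unique : ∀ n k → Unique (words n k)
  words-Unique zero k = All.[] AP.∷ AP.[]
  words-Unique (suc n) k = consAll-Unique (upTo k) (words n k) (upTo⁺ k) (words-Unique n k)

  toNCP?-isNCP : ∀ p (h : T (isNCP p)) → toNCP? p ≡ just (p , h)
  toNCP?-isNCP p h with T? (isNCP p)
  ... | yes h′ = cong (λ z → just (p , z)) (T-irrelevant h′ h)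
  ... | no ¬h = ⊥-elim (¬h h)

  toNCP?-just⁻ : ∀ p P → toNCP? p ≡ just P → proj₁ P ≡ p
  toNCP?-just⁻ p P e with T? (isNCP p)
  toNCP?-just⁻ p P refl | yes _ = refl

  ∈-catMaybes-toNCP?⁺ : ∀ (l : List (List ℕ)) (P : NCP) → proj₁ P ∈ l → P ∈ catMaybes (map toNCP? l)
  ∈-catMaybes-toNCP?⁺ (p ∷ l) (p′ , h) (here refl) rewrite toNCP?-isNCP p′ h = here refl
  ∈-catMaybes-toNCP?⁺ (p ∷ l) P (there m) with toNCP? p
  ... | just _ = there (∈-catMaybes-toNCP?⁺ l P m)
  ... | nothing = ∈-catMaybes-toNCP?⁺ l P m

  ∈-catMaybes-toNCP?⁻ : ∀ (l : List (List ℕ)) (P : NCP) → P ∈ catMaybes (map toNCP? l) → proj₁ P ∈ l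
  ∈-catMaybes-toNCP?⁻ (p ∷ l) P m with toNCP? p in e
  ∈-catMaybes-toNCP?⁻ (p ∷ l) P (here refl) | just _ = here (toNCP?-just⁻ p P e)
  ∈-catMaybes-toNCP?⁻ (p ∷ l) P (there m) | just _ = there (∈-catMaybes-toNCP?⁻ l P m)
  ... | nothing = there (∈-catMaybes-toNCP?⁻ l P m)

  catMaybes-toNCP?-Unique : ∀ (l : List (List ℕ)) → Unique l → Unique (catMaybes (map toNCP? l))
  catMaybes-toNCP?-Unique [] _ = AP.[]
  catMaybes-toNCP?-Unique (p ∷ l) (p∉l AP.∷ u) with toNCP? p in e
  ... | just P = All.tabulate (λ {Q} m Q≡P → All.lookup p∉l (∈-catMaybes-toNCP?⁻ l Q m)
                   (trans (sym (toNCP?-just⁻ p P e)) (cong proj₁ Q≡P)))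
                 AP.∷ catMaybes-toNCP?-Unique l u
  ... | nothing = catMaybes-toNCP?-Unique l u

  NCPs-Unique : ∀ n → Unique (NCPs n)
  NCPs-Unique n = catMaybes-toNCP?-Unique (words n n) (words-Unique n n)

  ∈-NCPs⁺ : ∀ (P : NCP) → P ∈ NCPs (size P)
  ∈-NCPs⁺ P = ∈-catMaybes-toNCP?⁺ (words (size P) (size P)) P
    (∈-words⁺ (size P) (size P) (proj₁ P) refl (isRGS-bound (proj₁ P) (NCP-isRGS P)))

  ∈-NCPs⁻ : ∀ n (P : NCP) → P ∈ NCPs n → size P ≡ n
  ∈-NCPs⁻ n P m = ∈-words⁻ n n (proj₁ P) (∈-catMaybes-toNCP?⁻ (words n n) P m)

  -- Order, noncrossing condition, restriction to a block

  Finer : List ℕ → List ℕ → Set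
  Finer p q = (length p ≡ length q) × (∀ i j → i < length p → j < length p → at p i ≡ at p j → at q i ≡ at q j)

  leqL⁻ : ∀ p q → T (leqL p q) → Finer p q
  leqL⁻ p q h with T-∧⁻ {length p == length q} h
  ... | (a , b) = ==→≡ a , λ i j hi hj e →
    case T-∨⁻ {not (at p i == at p j)} (T-all-upTo⁻ _ (length p) (T-all-upTo⁻ _ (length p) b i hi) j hj) of λ where
      (inj₁ p≢) → ⊥-elim (T-not⁻ p≢ (≡→== e))
      (inj₂ q≡) → ==→≡ q≡

  leqL⁺ : ∀ p q → Finer p q → T (leqL p q)
  leqL⁺ p q (a , b) = T-∧⁺ (≡→== a) (T-all-upTo⁺ _ (length p) λ i hi → T-all-upTo⁺ _ (length p) λ j hj → pair i j hi hj)
    where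
    pair : ∀ i j → i < length p → j < length p → T (not (at p i == at p j) ∨ (at q i == at q j))
    pair i j hi hj with at p i ≟ at p j
    ... | yes e = T-∨⁺ʳ {not (at p i == at p j)} (≡→== (b i j hi hj e))
    ... | no ne = T-∨⁺ˡ (T-not⁺ (λ t → ne (==→≡ t)))

  Noncrossing : List ℕ → Set
  Noncrossing p = ∀ a c b d → d < length p → a < c → c < b → b < d →
    at p a ≡ at p b → at p c ≡ at p d → at p a ≡ at p c

  isNoncrossing⁻ : ∀ p → T (isNoncrossing p) → Noncrossing p
  isNoncrossing⁻ p h a c b d hd a<c c<b b<d ab cd with at p a ≟ at p c
  ... | yes e = e
  ... | no ne = ⊥-elim (T-not⁻ forbidden (T-∧⁺ (<⇒<ᵇ a<c) (T-∧⁺ (<⇒<ᵇ c<b) (T-∧⁺ (<⇒<ᵇ b<d)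
                  (T-∧⁺ (≡→== ab) (T-∧⁺ (≡→== cd) (T-not⁺ (λ x → ne (==→≡ x)))))))))
    where
    n = length p
    hb = <-trans b<d hd
    hc = <-trans c<b hb
    forbidden = T-all-upTo⁻ _ n (T-all-upTo⁻ _ n (T-all-upTo⁻ _ n (T-all-upTo⁻ _ n h a (<-trans a<c hc)) c hc) b hb) d hd

  isNoncrossing⁺ : ∀ p → Noncrossing p → T (isNoncrossing p)
  isNoncrossing⁺ p nc =
    T-all-upTo⁺ _ n λ a _ → T-all-upTo⁺ _ n λ c _ → T-all-upTo⁺ _ n λ b _ → T-all-upTo⁺ _ n λ d hd →
      T-not⁺ (notCrossing a c b d hd)
    where
    n = length p
    notCrossing : ∀ a c b d → d < n → ¬ T ((a <ᵇ c) ∧ (c <ᵇ b) ∧ (b <ᵇ d)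
                    ∧ (at p a == at p b) ∧ (at p c == at p d) ∧ not (at p a == at p c))
    notCrossing a c b d hd t
      with T-∧⁻ {a <ᵇ c} t
    ... | (t₁ , t) with T-∧⁻ {c <ᵇ b} t
    ... | (t₂ , t) with T-∧⁻ {b <ᵇ d} t
    ... | (t₃ , t) with T-∧⁻ {at p a == at p b} t
    ... | (t₄ , t) with T-∧⁻ {at p c == at p d} t
    ... | (t₅ , t₆) =
      T-not⁻ t₆ (≡→== (nc a c b d hd (<ᵇ⇒< a c t₁) (<ᵇ⇒< c b t₂) (<ᵇ⇒< b d t₃) (==→≡ t₄) (==→≡ t₅)))

  Noncrossing-kernel : ∀ p p′ → length p ≡ length p′ → SameKernel (length p) p p′ → Noncrossing p′ → Noncrossing p
  Noncrossing-kernel p p′ l ker nc a c b d hd a<c c<b b<d ab cd =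
    proj₂ (ker a c ha hc) (nc a c b d (subst (d <_) l hd) a<c c<b b<d (proj₁ (ker a b ha hb) ab) (proj₁ (ker c d hc hd) cd))
    where
    hb = <-trans b<d hd
    hc = <-trans c<b hb
    ha = <-trans a<c hc

  Increasing : List ℕ → Set
  Increasing I = ∀ u v → v < length I → u < v → at I u < at I v

  Increasing-map-suc : ∀ I → Increasing I → Increasing (map suc I)
  Increasing-map-suc I h u v hv u<v =
    subst₂ _<_ (sym (at-map suc I u (<-trans u<v hv′))) (sym (at-map suc I v hv′)) (s≤s (h u v hv′ u<v))
    where hv′ = subst (v <_) (length-map suc I) hv

  Increasing-0∷map-suc : ∀ I → Increasing I → Increasing (0 ∷ map suc I)
  Increasing-0∷map-suc I h zero (suc v) (s≤s hv) _ =
    subst (0 <_) (sym (at-map suc I v (subst (v <_) (length-map suc I) hv))) (s≤s z≤n)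
  Increasing-0∷map-suc I h (suc u) (suc v) (s≤s hv) (s≤s u<v) = Increasing-map-suc I h u v hv u<v

  Increasing-reflects-< : ∀ I → Increasing I → ∀ u v → u < length I → v < length I → at I u < at I v → u < v
  Increasing-reflects-< I h u v hu hv lt with <-cmp u v
  ... | tri< u<v _ _ = u<v
  ... | tri≈ _ refl _ = ⊥-elim (<-irrefl refl lt)
  ... | tri> _ _ v<u = ⊥-elim (<-asym lt (h v u hu v<u))

  Noncrossing-subsequence : ∀ p I → Increasing I → (∀ u → u < length I → at I u < length p) →
    Noncrossing p → Noncrossing (map (at p) I)
  Noncrossing-subsequence p I inc bound nc a c b d hd a<c c<b b<d ab cd =
    subst₂ _≡_ (sym (at-I ha)) (sym (at-I hc))
      (nc (at I a) (at I c) (at I b) (at I d) (bound d hd′) (inc a c hc a<c) (inc c b hb c<b) (inc b d hd′ b<d)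
        (subst₂ _≡_ (at-I ha) (at-I hb) ab) (subst₂ _≡_ (at-I hc) (at-I hd′) cd))
    where
    at-I : ∀ {u} → u < length I → at (map (at p) I) u ≡ at p (at I u)
    at-I = at-map (at p) I _
    hd′ = subst (d <_) (length-map (at p) I) hd
    hb = <-trans b<d hd′
    hc = <-trans c<b hb
    ha = <-trans a<c hc

  positions : List ℕ → ℕ → List ℕ
  positions [] b = []
  positions (y ∷ q) b = if y == b then 0 ∷ map suc (positions q b) else map suc (positions q b)

  positions-Increasing : ∀ q b → Increasing (positions q b)
  positions-Increasing [] b u v ()
  positions-Increasing (y ∷ q) b with y == b
  ... | true = Increasing-0∷map-suc (positions q b) (positions-Increasing q b)
  ... | false = Increasing-map-suc (positions q b) (positions-Increasing q b)

  positions-sound : ∀ q b u → u < length (positions q b) →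
    (at (positions q b) u < length q) × (at q (at (positions q b) u) ≡ b)
  positions-sound-∷ : ∀ y q b u → u < length (map suc (positions q b)) →
    (at (map suc (positions q b)) u < suc (length q)) × (at (y ∷ q) (at (map suc (positions q b)) u) ≡ b)

  positions-sound (y ∷ q) b u h with y == b in eq | u | h
  ... | true | zero | _ = s≤s z≤n , ==→≡ (subst T (sym eq) tt)
  ... | true | suc u′ | s≤s h′ = positions-sound-∷ y q b u′ h′
  ... | false | u′ | h′ = positions-sound-∷ y q b u′ h′

  positions-sound-∷ y q b u h =
    let h′ = subst (u <_) (length-map suc (positions q b)) h
        (a , c) = positions-sound q b u h′
        e = sym (at-map suc (positions q b) u h′)
    in subst (_< suc (length q)) e (s≤s a) , subst (λ z → at (y ∷ q) z ≡ b) e c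

  positions-complete : ∀ q b i → i < length q → at q i ≡ b →
    Σ ℕ λ u → (u < length (positions q b)) × (at (positions q b) u ≡ i)
  positions-complete (y ∷ q) b zero h e with y == b in eq
  ... | true = 0 , s≤s z≤n , refl
  ... | false = ⊥-elim (subst T eq (≡→== e))
  positions-complete (y ∷ q) b (suc i) (s≤s h) e with positions-complete q b i h e
  ... | (u , hu , e′) with y == b
  ...   | true = suc u , s≤s (subst (u <_) (sym (length-map suc (positions q b))) hu) , trans (at-map suc (positions q b) u hu) (cong suc e′)
  ...   | false = u , subst (u <_) (sym (length-map suc (positions q b))) hu , trans (at-map suc (positions q b) u hu) (cong suc e′)

  length-positions : ∀ q b → length (positions q b) ≤ length q
  length-positions [] b = z≤n
  length-positions (y ∷ q) b with y == b
  ... | true = s≤s (subst (_≤ length q) (sym (length-map suc (positions q b))) (length-positions q b))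
  ... | false = ≤-trans (≤-reflexive (length-map suc (positions q b))) (≤-trans (length-positions q b) (n≤1+n _))

  -- P|τ before standardization, τ the block of q labelled b.
  rawRestrict : List ℕ → List ℕ → ℕ → List ℕ
  rawRestrict p q b = map proj₁ (filter (λ pq → proj₂ pq ℕ.≟ b) (zip p q))

  map-at-∷-suc : ∀ x p I → map (at (x ∷ p)) (map suc I) ≡ map (at p) I
  map-at-∷-suc x p [] = refl
  map-at-∷-suc x p (i ∷ I) = cong (at p i ∷_) (map-at-∷-suc x p I)

  rawRestrict-positions : ∀ p q b → length p ≡ length q → rawRestrict p q b ≡ map (at p) (positions q b)
  rawRestrict-positions [] [] b _ = refl
  rawRestrict-positions (x ∷ p) (y ∷ q) b l with y == b
  ... | true = cong (x ∷_) (trans (rawRestrict-positions p q b (suc-injective l)) (sym (map-at-∷-suc x p (positions q b))))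
  ... | false = trans (rawRestrict-positions p q b (suc-injective l)) (sym (map-at-∷-suc x p (positions q b)))

  length-rawRestrict : ∀ p q b → length p ≡ length q → length (rawRestrict p q b) ≡ length (positions q b)
  length-rawRestrict p q b l = trans (cong length (rawRestrict-positions p q b l)) (length-map (at p) (positions q b))

  length-restrict : ∀ p q b → length p ≡ length q → length (restrictToBlock p q b) ≡ length (positions q b)
  length-restrict p q b l = trans (length-stdFrom [] (rawRestrict p q b)) (length-rawRestrict p q b l)

  restrict-kernel : ∀ p q b → length p ≡ length q → ∀ u v → u < length (positions q b) → v < length (positions q b) →
    (at (restrictToBlock p q b) u ≡ at (restrictToBlock p q b) v) ⇔ (at p (at (positions q b) u) ≡ at p (at (positions q b) v))
  restrict-kernel p q b l u v hu hv =
    subst₂ (λ x y → (at (restrictToBlock p q b) u ≡ at (restrictToBlock p q b) v) ⇔ (x ≡ y))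
      (at-map (at p) (positions q b) u hu) (at-map (at p) (positions q b) v hv)
      (subst (λ z → (at (restrictToBlock p q b) u ≡ at (restrictToBlock p q b) v) ⇔ (at z u ≡ at z v)) (rawRestrict-positions p q b l)
        (stdFrom-kernel [] (rawRestrict p q b) u v (subst (u <_) eqlen hu) (subst (v <_) eqlen hv)))
    where eqlen = sym (length-rawRestrict p q b l)

  restrict-kernel-subsequence : ∀ p q b → length p ≡ length q →
    SameKernel (length (positions q b)) (restrictToBlock p q b) (map (at p) (positions q b))
  restrict-kernel-subsequence p q b l u v hu hv =
    subst₂ (λ x y → (at (restrictToBlock p q b) u ≡ at (restrictToBlock p q b) v) ⇔ (x ≡ y))
      (sym (at-map (at p) (positions q b) u hu)) (sym (at-map (at p) (positions q b) v hv)) (restrict-kernel p q b l u v hu hv)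

  restrict-isNCP : ∀ p q b → length p ≡ length q → T (isNoncrossing p) → (Σ ℕ λ i → (i < length q) × (at q i ≡ b)) →
    T (isNCP (restrictToBlock p q b))
  restrict-isNCP p q b l nc (i , hi , e) =
    isNCP⁺ r (nonempty⁺ r (subst (0 <_) (sym (length-restrict p q b l)) (≤-<-trans z≤n hu)))
      (standardize-isRGS (rawRestrict p q b)) (isNoncrossing⁺ r ncr)
    where
    r = restrictToBlock p q b
    I = positions q b
    hu = proj₁ (proj₂ (positions-complete q b i hi e))
    ncr : Noncrossing r
    ncr = Noncrossing-kernel r (map (at p) I) (trans (length-restrict p q b l) (sym (length-map (at p) I)))
            (subst (λ z → SameKernel z r (map (at p) I)) (sym (length-restrict p q b l)) (restrict-kernel-subsequence p q b l))
            (Noncrossing-subsequence p I (positions-Increasing q b)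
              (λ u hu → subst (at I u <_) (sym l) (proj₁ (positions-sound q b u hu))) (isNoncrossing⁻ p nc))

  asNCP-id : ∀ p (h : T (isNCP p)) → asNCP p ≡ (p , h)
  asNCP-id p h with T? (isNCP p)
  ... | yes h′ = cong (p ,_) (T-irrelevant h′ h)
  ... | no ¬h = ⊥-elim (¬h h)

  asNCP-proj : ∀ p → T (isNCP p) → proj₁ (asNCP p) ≡ p
  asNCP-proj p h = cong proj₁ (asNCP-id p h)

  restrict-mono : ∀ p m q t → length p ≡ length q → length m ≡ length q → Finer p m →
    Finer (restrictToBlock p q t) (restrictToBlock m q t)
  restrict-mono p m q t lp lm (_ , H) = trans (length-restrict p q t lp) (sym (length-restrict m q t lm)) , λ u v hu hv e →
    let hu′ = subst (u <_) (length-restrict p q t lp) hu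
        hv′ = subst (v <_) (length-restrict p q t lp) hv
        iu = subst (at (positions q t) u <_) (sym lp) (proj₁ (positions-sound q t u hu′))
        iv = subst (at (positions q t) v <_) (sym lp) (proj₁ (positions-sound q t v hv′))
    in proj₂ (restrict-kernel m q t lm u v hu′ hv′) (H _ _ iu iv (proj₁ (restrict-kernel p q t lp u v hu′ hv′) e))

  rank : List ℕ → ℕ → ℕ
  rank q i = fromMaybe 0 (indexOf i (positions q (at q i)))

  indexOf-positions : ∀ q b u → u < length (positions q b) → indexOf (at (positions q b) u) (positions q b) ≡ just u
  indexOf-positions q b u hu = indexOf-just⁺ (at (positions q b) u) (positions q b) u hu refl
    (λ u′ u′<u e → <-irrefl e (positions-Increasing q b u′ u hu u′<u))

  rank-positions : ∀ q b u → u < length (positions q b) → rank q (at (positions q b) u) ≡ u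
  rank-positions q b u hu rewrite proj₂ (positions-sound q b u hu) | indexOf-positions q b u hu = refl

  rank-sound : ∀ q i → i < length q →
    (rank q i < length (positions q (at q i))) × (at (positions q (at q i)) (rank q i) ≡ i)
  rank-sound q i hi with positions-complete q (at q i) i hi refl
  ... | (u , hu , e) =
    subst (λ z → rank q z < length I) e (subst (_< length I) (sym (rank-positions q (at q i) u hu)) hu) ,
    subst (λ z → at I (rank q z) ≡ z) e (cong (at I) (rank-positions q (at q i) u hu))
    where I = positions q (at q i)

  pairing-injective : ∀ n t t′ x x′ → x < n → x′ < n → t * n + x ≡ t′ * n + x′ → (t ≡ t′) × (x ≡ x′)
  pairing-injective n zero zero x x′ hx hx′ e = refl , e
  pairing-injective n zero (suc t′) x x′ hx hx′ e =
    ⊥-elim (<⇒≱ hx (subst (n ≤_) (trans (sym (+-assoc n (t′ * n) x′)) (sym e)) (m≤m+n n (t′ * n + x′))))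
  pairing-injective n (suc t) zero x x′ hx hx′ e =
    ⊥-elim (<⇒≱ hx′ (subst (n ≤_) (trans (sym (+-assoc n (t * n) x)) e) (m≤m+n n (t * n + x))))
  pairing-injective n (suc t) (suc t′) x x′ hx hx′ e =
    let (a , b) = pairing-injective n t t′ x x′ hx hx′
                    (+-cancelˡ-≡ n _ _ (trans (sym (+-assoc n (t * n) x)) (trans e (+-assoc n (t′ * n) x′))))
    in cong suc a , b

  kernel-via-blocks : ∀ m q → Finer m q → ∀ i j → i < length m → j < length m →
    (at m i ≡ at m j) ⇔
    ((at q i ≡ at q j) × (at (restrictToBlock m q (at q i)) (rank q i) ≡ at (restrictToBlock m q (at q i)) (rank q j)))
  kernel-via-blocks m q (l , H) i j hi hj = to , from
    where
    b = at q i
    r = restrictToBlock m q b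
    si = rank-sound q i (subst (i <_) l hi)
    sj : at q i ≡ at q j → (rank q j < length (positions q b)) × (at (positions q b) (rank q j) ≡ j)
    sj eq = subst (λ z → (rank q j < length (positions q z)) × (at (positions q z) (rank q j) ≡ j)) (sym eq)
              (rank-sound q j (subst (j <_) l hj))
    ker : at q i ≡ at q j → (at r (rank q i) ≡ at r (rank q j)) ⇔ (at m i ≡ at m j)
    ker eq = subst₂ (λ x y → (at r (rank q i) ≡ at r (rank q j)) ⇔ (at m x ≡ at m y)) (proj₂ si) (proj₂ (sj eq))
               (restrict-kernel m q b l (rank q i) (rank q j) (proj₁ si) (proj₁ (sj eq)))
    to : at m i ≡ at m j → (at q i ≡ at q j) × (at r (rank q i) ≡ at r (rank q j))
    to e = let eq = H i j hi hj e in eq , proj₂ (ker eq) e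
    from : (at q i ≡ at q j) × (at r (rank q i) ≡ at r (rank q j)) → at m i ≡ at m j
    from (eq , e) = proj₁ (ker eq) e

  -- Lookup in a list of partitions; the default is never used below.
  atN : List NCP → ℕ → NCP
  atN [] _ = (0 ∷ [] , tt)
  atN (x ∷ xs) zero = x
  atN (x ∷ xs) (suc i) = atN xs i

  applyUpTo-atN : ∀ z → applyUpTo (atN z) (length z) ≡ z
  applyUpTo-atN [] = refl
  applyUpTo-atN (x ∷ z) = cong (x ∷_) (applyUpTo-atN z)

  map-atN-upTo : ∀ z → map (atN z) (upTo (length z)) ≡ z
  map-atN-upTo z = trans (map-applyUpTo (λ i → i) (atN z) (length z)) (applyUpTo-atN z)

  atN-applyUpTo : ∀ (f : ℕ → NCP) n u → u < n → atN (applyUpTo f n) u ≡ f u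
  atN-applyUpTo f (suc n) zero _ = refl
  atN-applyUpTo f (suc n) (suc u) (s≤s h) = atN-applyUpTo (λ i → f (suc i)) n u h

  atN-map-upTo : ∀ (f : ℕ → NCP) n u → u < n → atN (map f (upTo n)) u ≡ f u
  atN-map-upTo f n u h = trans (cong (λ l → atN l u) (map-applyUpTo (λ i → i) f n)) (atN-applyUpTo f n u h)

  select : ∀ {A : Set} → (A → Bool) → List A → List A
  select c [] = []
  select c (x ∷ xs) = if c x then x ∷ select c xs else select c xs

  ∈-select⁺ : ∀ {A : Set} (c : A → Bool) {x} xs → x ∈ xs → T (c x) → x ∈ select c xs
  ∈-select⁺ c (y ∷ xs) (here refl) h with c y
  ... | true = here refl
  ∈-select⁺ c (y ∷ xs) (there m) h with c y
  ... | true = there (∈-select⁺ c xs m h)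
  ... | false = ∈-select⁺ c xs m h

  ∈-select⁻ : ∀ {A : Set} (c : A → Bool) {x} xs → x ∈ select c xs → (x ∈ xs) × T (c x)
  ∈-select⁻ c (y ∷ xs) m with c y in e
  ∈-select⁻ c (y ∷ xs) (here refl) | true = here refl , subst T (sym e) tt
  ∈-select⁻ c (y ∷ xs) (there m) | true = let (a , b) = ∈-select⁻ c xs m in there a , b
  ... | false = let (a , b) = ∈-select⁻ c xs m in there a , b

  select-Unique : ∀ {A : Set} (c : A → Bool) xs → Unique xs → Unique (select c xs)
  select-Unique c [] u = AP.[]
  select-Unique c (x ∷ xs) (x∉xs AP.∷ u) with c x
  ... | true = All.tabulate (λ m → All.lookup x∉xs (proj₁ (∈-select⁻ c xs m))) AP.∷ select-Unique c xs u
  ... | false = select-Unique c xs u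

  concatMap-concatMap : ∀ {a b d} {A : Set a} {B : Set b} {C : Set d} (h : B → List C) (f : A → List B) L →
    concatMap h (concatMap f L) ≡ concatMap (λ x → concatMap h (f x)) L
  concatMap-concatMap h f [] = refl
  concatMap-concatMap h f (x ∷ L) =
    trans (concatMap-++ h (f x) (concatMap f L)) (cong (concatMap h (f x) ++_) (concatMap-concatMap h f L))

  concatMap-if : ∀ {A B : Set} (c : A → Bool) (g : A → B) L →
    concatMap (λ x → if c x then [ g x ] else []) L ≡ map g (select c L)
  concatMap-if c g [] = refl
  concatMap-if c g (x ∷ L) with c x
  ... | true = cong (g x ∷_) (concatMap-if c g L)
  ... | false = concatMap-if c g L

  map-Unique-injectiveOn : ∀ {A B : Set} (f : A → B) xs → Unique xs →
    (∀ {x y} → x ∈ xs → y ∈ xs → f x ≡ f y → x ≡ y) → Unique (map f xs)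
  map-Unique-injectiveOn f [] u inj = AP.[]
  map-Unique-injectiveOn f (x ∷ xs) (x∉xs AP.∷ u) inj =
    All.tabulate (λ m e → let (y , y∈xs , ez) = ∈-map⁻ f m in All.lookup x∉xs y∈xs (inj (here refl) (there y∈xs) (trans e ez)))
    AP.∷ map-Unique-injectiveOn f xs u (λ mx my e → inj (there mx) (there my) e)

  concatMap-Unique : ∀ {A B : Set} (f : A → List B) xs → Unique xs → (∀ x → x ∈ xs → Unique (f x)) →
    (∀ {x y z} → x ∈ xs → y ∈ xs → z ∈ f x → z ∈ f y → x ≡ y) → Unique (concatMap f xs)
  concatMap-Unique f [] _ _ _ = AP.[]
  concatMap-Unique f (x ∷ xs) (x∉xs AP.∷ u) U D =
    ++⁺ (U x (here refl)) (concatMap-Unique f xs u (λ y m → U y (there m)) (λ mx my z₁ z₂ → D (there mx) (there my) z₁ z₂)) disjoint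
    where
    disjoint : Disjoint (f x) (concatMap f xs)
    disjoint (m₁ , m₂) with find (∈-concatMap⁻ f m₂)
    ... | (y , y∈xs , m) = All.lookup x∉xs y∈xs (D (here refl) (there y∈xs) m₁ m)

  Above : NCP → NCP → Set
  Above R Z = (Z ∈ NCPs (size R)) × T (R ≤P Z)

  Above* : List NCP → List NCP → Set
  Above* [] [] = ⊤
  Above* (R ∷ rs) (Z ∷ zs) = Above R Z × Above* rs zs
  Above* _ _ = ⊥

  Above*-length : ∀ rs z → Above* rs z → length rs ≡ length z
  Above*-length [] [] _ = refl
  Above*-length (R ∷ rs) (Z ∷ zs) (_ , h) = cong suc (Above*-length rs zs h)

  Above*-atN : ∀ rs z → Above* rs z → ∀ u → u < length rs → Above (atN rs u) (atN z u)
  Above*-atN (R ∷ rs) (Z ∷ zs) (r , h) zero _ = r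
  Above*-atN (R ∷ rs) (Z ∷ zs) (r , h) (suc u) (s≤s hu) = Above*-atN rs zs h u hu

  Above*-map : ∀ (f g : ℕ → NCP) L → (∀ t → t ∈ L → Above (f t) (g t)) → Above* (map f L) (map g L)
  Above*-map f g [] h = tt
  Above*-map f g (t ∷ L) h = h t (here refl) , Above*-map f g L (λ t′ m → h t′ (there m))

  -- The index set of δ(R₁ ⋯ R_k): tuples (Z₁, …, Z_k) with Zᵢ ≥ Rᵢ.
  upperTuples : List NCP → List (List NCP)
  upperTuples [] = [ [] ]
  upperTuples (R ∷ rs) = consAll (select (R ≤P_) (NCPs (size R))) (upperTuples rs)

  ∈-upperTuples⁺ : ∀ rs z → Above* rs z → z ∈ upperTuples rs
  ∈-upperTuples⁺ [] [] _ = here refl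
  ∈-upperTuples⁺ (R ∷ rs) (Z ∷ zs) ((m , le) , h) =
    ∈-consAll⁺ (select (R ≤P_) (NCPs (size R))) (upperTuples rs) (∈-select⁺ (R ≤P_) (NCPs (size R)) m le) (∈-upperTuples⁺ rs zs h)

  ∈-upperTuples⁻ : ∀ rs z → z ∈ upperTuples rs → Above* rs z
  ∈-upperTuples⁻ [] [] _ = tt
  ∈-upperTuples⁻ [] (_ ∷ _) (here ())
  ∈-upperTuples⁻ [] (_ ∷ _) (there ())
  ∈-upperTuples⁻ (R ∷ rs) z m with ∈-consAll⁻ (select (R ≤P_) (NCPs (size R))) (upperTuples rs) m
  ... | (Z , zs , refl , mZ , mzs) = ∈-select⁻ (R ≤P_) (NCPs (size R)) mZ , ∈-upperTuples⁻ rs zs mzs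

  upperTuples-Unique : ∀ rs → Unique (upperTuples rs)
  upperTuples-Unique [] = All.[] AP.∷ AP.[]
  upperTuples-Unique (R ∷ rs) =
    consAll-Unique (select (R ≤P_) (NCPs (size R))) (upperTuples rs)
      (select-Unique (R ≤P_) (NCPs (size R)) (NCPs-Unique (size R))) (upperTuples-Unique rs)

  -- For P ≤ Q, M ↦ M/Q (the list of restrictions of M to the blocks of Q) is a bijection from the
  -- interval [P, Q] onto the tuples above P/Q.
  module IntervalBlocks (P Q : NCP) (P≤Q : Finer (proj₁ P) (proj₁ Q)) where
    p = proj₁ P
    q = proj₁ Q
    n = length p
    k = nblocks q

    lpq : length p ≡ length q
    lpq = proj₁ P≤Q

    n>0 : 0 < n
    n>0 = nonempty⁻ p (NCP-nonempty P)

    block<k : ∀ i → i < n → at q i < k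
    block<k i hi = at<nblocks q i (subst (i <_) lpq hi)

    length-positions≤n : ∀ t → length (positions q t) ≤ n
    length-positions≤n t = subst (length (positions q t) ≤_) (sym lpq) (length-positions q t)

    rank-in-block : ∀ i t → i < n → at q i ≡ t → (rank q i < length (positions q t)) × (at (positions q t) (rank q i) ≡ i)
    rank-in-block i t hi refl = rank-sound q i (subst (i <_) lpq hi)

    restriction-isNCP : ∀ (m : NCP) t → length (proj₁ m) ≡ length q → t < k → T (isNCP (restrictToBlock (proj₁ m) q t))
    restriction-isNCP m t l h = restrict-isNCP (proj₁ m) q t l (NCP-isNoncrossing m) (isRGS-labels-occur q (NCP-isRGS Q) t h)

    blockRestriction : NCP → ℕ → NCP
    blockRestriction m t = asNCP (restrictToBlock (proj₁ m) q t)

    blockRestriction-proj : ∀ (m : NCP) t → length (proj₁ m) ≡ length q → t < k →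
      proj₁ (blockRestriction m t) ≡ restrictToBlock (proj₁ m) q t
    blockRestriction-proj m t l h = asNCP-proj _ (restriction-isNCP m t l h)

    blockRestrictions : NCP → List NCP
    blockRestrictions m = map (blockRestriction m) (upTo k)

    length-blockRestrictions : ∀ m → length (blockRestrictions m) ≡ k
    length-blockRestrictions m = trans (length-map (blockRestriction m) (upTo k)) (length-upTo k)

    blockRestriction-∈-NCPs : ∀ (m : NCP) t → length (proj₁ m) ≡ length q → t < k →
      blockRestriction m t ∈ NCPs (size (blockRestriction P t))
    blockRestriction-∈-NCPs m t l h = subst (λ s → blockRestriction m t ∈ NCPs s) same-size (∈-NCPs⁺ (blockRestriction m t))
      where
      same-size : size (blockRestriction m t) ≡ size (blockRestriction P t)
      same-size = begin
        size (blockRestriction m t)          ≡⟨ cong length (blockRestriction-proj m t l h) ⟩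
        length (restrictToBlock (proj₁ m) q t) ≡⟨ length-restrict (proj₁ m) q t l ⟩
        length (positions q t)               ≡⟨ length-restrict p q t lpq ⟨
        length (restrictToBlock p q t)       ≡⟨ cong length (blockRestriction-proj P t lpq h) ⟨
        size (blockRestriction P t)          ∎
        where open ≡-Reasoning

    blockRestrictions-above : ∀ (m : NCP) → length (proj₁ m) ≡ length q → Finer p (proj₁ m) →
      Above* (blockRestrictions P) (blockRestrictions m)
    blockRestrictions-above m l P≤m = Above*-map (blockRestriction P) (blockRestriction m) (upTo k) λ t t∈ →
      let h = ∈-upTo⁻ t∈ in
      blockRestriction-∈-NCPs m t l h ,
      subst₂ (λ x y → T (leqL x y)) (sym (blockRestriction-proj P t lpq h)) (sym (blockRestriction-proj m t l h))
        (leqL⁺ (restrictToBlock p q t) (restrictToBlock (proj₁ m) q t) (restrict-mono p (proj₁ m) q t lpq l P≤m))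

    blockRestrictions-injective : ∀ (m m′ : NCP) → Finer (proj₁ m) q → Finer (proj₁ m′) q →
      blockRestrictions m ≡ blockRestrictions m′ → m ≡ m′
    blockRestrictions-injective m m′ m≤Q m′≤Q e =
      NCP-≡ (isRGS-kernel-unique (proj₁ m) (proj₁ m′) (NCP-isRGS m) (NCP-isRGS m′) lmm′ sameKernel)
      where
      lmm′ = trans (proj₁ m≤Q) (sym (proj₁ m′≤Q))
      sameRestriction : ∀ t → t < k → restrictToBlock (proj₁ m) q t ≡ restrictToBlock (proj₁ m′) q t
      sameRestriction t h = begin
        restrictToBlock (proj₁ m) q t                 ≡⟨ blockRestriction-proj m t (proj₁ m≤Q) h ⟨
        proj₁ (blockRestriction m t)                  ≡⟨ cong proj₁ (atN-map-upTo (blockRestriction m) k t h) ⟨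
        proj₁ (atN (blockRestrictions m) t)           ≡⟨ cong (λ z → proj₁ (atN z t)) e ⟩
        proj₁ (atN (blockRestrictions m′) t)          ≡⟨ cong proj₁ (atN-map-upTo (blockRestriction m′) k t h) ⟩
        proj₁ (blockRestriction m′ t)                 ≡⟨ blockRestriction-proj m′ t (proj₁ m′≤Q) h ⟩
        restrictToBlock (proj₁ m′) q t                ∎
        where open ≡-Reasoning
      sameKernel : SameKernel (length (proj₁ m)) (proj₁ m) (proj₁ m′)
      sameKernel i j hi hj =
        let hq = at<nblocks q i (subst (i <_) (proj₁ m≤Q) hi)
            transport = subst (λ r → at r (rank q i) ≡ at r (rank q j)) (sameRestriction (at q i) hq)
            (to , from) = kernel-via-blocks (proj₁ m) q m≤Q i j hi hj
            (to′ , from′) = kernel-via-blocks (proj₁ m′) q m′≤Q i j (subst (i <_) lmm′ hi) (subst (j <_) lmm′ hj)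
        in (λ e → let (a , b) = to e in from′ (a , transport b)) ,
           (λ e → let (a , b) = to′ e in from (a , subst (λ r → at r (rank q i) ≡ at r (rank q j)) (sym (sameRestriction (at q i) hq)) b))

    -- Gluing a tuple z above P/Q into a partition of [n]: position i gets the code
    -- q_i · n + (label of i in the component of its block), which is then standardized.
    module Glue (z : List NCP) (hz : Above* (blockRestrictions P) z) where
      length-tuple : length z ≡ k
      length-tuple = trans (sym (Above*-length (blockRestrictions P) z hz)) (length-blockRestrictions P)

      component : ℕ → List ℕ
      component t = proj₁ (atN z t)

      component-above : ∀ t → t < k → Above (blockRestriction P t) (atN z t)
      component-above t h = subst (λ R → Above R (atN z t)) (atN-map-upTo (blockRestriction P) k t h)
        (Above*-atN (blockRestrictions P) z hz t (subst (t <_) (sym (length-blockRestrictions P)) h))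

      length-component : ∀ t → t < k → length (component t) ≡ length (positions q t)
      length-component t h = trans (∈-NCPs⁻ _ (atN z t) (proj₁ (component-above t h)))
        (trans (cong length (blockRestriction-proj P t lpq h)) (length-restrict p q t lpq))

      component-finer : ∀ t → t < k → Finer (restrictToBlock p q t) (component t)
      component-finer t h = leqL⁻ (restrictToBlock p q t) (component t)
        (subst (λ x → T (leqL x (component t))) (blockRestriction-proj P t lpq h) (proj₂ (component-above t h)))

      localLabel : ℕ → ℕ
      localLabel i = at (component (at q i)) (rank q i)

      localLabel-in-block : ∀ i t → at q i ≡ t → localLabel i ≡ at (component t) (rank q i)
      localLabel-in-block i t refl = refl

      localLabel<n : ∀ i → i < n → localLabel i < n
      localLabel<n i hi =
        let t = at q i; h = block<k i hi; (r< , _) = rank-in-block i t hi refl in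
        <-≤-trans (isRGS-bound (component t) (NCP-isRGS (atN z t)) (rank q i) (subst (rank q i <_) (sym (length-component t h)) r<))
          (subst (_≤ n) (sym (length-component t h)) (length-positions≤n t))

      code : List ℕ
      code = map (λ i → at q i * n + localLabel i) (upTo n)

      length-code : length code ≡ n
      length-code = trans (length-map _ (upTo n)) (length-upTo n)

      at-code : ∀ i → i < n → at code i ≡ at q i * n + localLabel i
      at-code i hi =
        trans (at-map (λ i → at q i * n + localLabel i) (upTo n) i (subst (i <_) (sym (length-upTo n)) hi))
          (cong (λ j → at q j * n + localLabel j) (at-upTo n i hi))

      code-kernel : ∀ i j → i < n → j < n → (at code i ≡ at code j) ⇔ ((at q i ≡ at q j) × (localLabel i ≡ localLabel j))
      code-kernel i j hi hj =
        (λ e → pairing-injective n (at q i) (at q j) (localLabel i) (localLabel j) (localLabel<n i hi) (localLabel<n j hj)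
                 (trans (sym (at-code i hi)) (trans e (at-code j hj)))) ,
        (λ { (a , b) → trans (at-code i hi) (trans (cong₂ (λ x y → x * n + y) a b) (sym (at-code j hj))) })

      glued : List ℕ
      glued = standardize code

      length-glued : length glued ≡ n
      length-glued = trans (length-stdFrom [] code) length-code

      glued-kernel : ∀ i j → i < n → j < n → (at glued i ≡ at glued j) ⇔ ((at q i ≡ at q j) × (localLabel i ≡ localLabel j))
      glued-kernel i j hi hj =
        ⇔-trans (stdFrom-kernel [] code i j (subst (i <_) (sym length-code) hi) (subst (j <_) (sym length-code) hj))
          (code-kernel i j hi hj)

      P≤glued : Finer p glued
      P≤glued = sym length-glued , λ i j hi hj e →
        let eq = proj₂ P≤Q i j hi hj e
            t = at q i
            (ri , ei) = rank-in-block i t hi refl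
            (rj , ej) = rank-in-block j t hj (sym eq)
            sameInP = proj₂ (restrict-kernel p q t lpq (rank q i) (rank q j) ri rj) (subst₂ (λ x y → at p x ≡ at p y) (sym ei) (sym ej) e)
            lr = sym (length-restrict p q t lpq)
            sameInComponent = proj₂ (component-finer t (block<k i hi)) (rank q i) (rank q j) (subst (rank q i <_) lr ri) (subst (rank q j <_) lr rj) sameInP
        in proj₂ (glued-kernel i j hi hj) (eq , trans sameInComponent (sym (localLabel-in-block j t (sym eq))))

      glued≤Q : Finer glued q
      glued≤Q = trans length-glued lpq , λ i j hi hj e →
        proj₁ (proj₁ (glued-kernel i j (subst (i <_) length-glued hi) (subst (j <_) length-glued hj)) e)

      -- Two crossing pairs of positions with equal codes lie in one block of Q (Q is noncrossing), and
      -- there their ranks cross as well, so the component of that block identifies them.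
      code-Noncrossing : Noncrossing code
      code-Noncrossing a c b d hd a<c c<b b<d ab cd =
        let hd′ = subst (d <_) length-code hd
            hb = <-trans b<d hd′
            hc = <-trans c<b hb
            ha = <-trans a<c hc
            (qab , xab) = proj₁ (code-kernel a b ha hb) ab
            (qcd , xcd) = proj₁ (code-kernel c d hc hd′) cd
            qac = isNoncrossing⁻ q (NCP-isNoncrossing Q) a c b d (subst (d <_) lpq hd′) a<c c<b b<d qab qcd
            t = at q a
            (ra , ea) = rank-in-block a t ha refl
            (rc , ec) = rank-in-block c t hc (sym qac)
            (rb , eb) = rank-in-block b t hb (sym qab)
            (rd , ed) = rank-in-block d t hd′ (trans (sym qcd) (sym qac))
            rank< : ∀ {x y} → x < length (positions q t) → y < length (positions q t) →
                    at (positions q t) x < at (positions q t) y → x < y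
            rank< hx hy = Increasing-reflects-< (positions q t) (positions-Increasing q t) _ _ hx hy
            sameLocal = isNoncrossing⁻ (component t) (NCP-isNoncrossing (atN z t)) (rank q a) (rank q c) (rank q b) (rank q d)
                          (subst (rank q d <_) (sym (length-component t (block<k a ha))) rd)
                          (rank< ra rc (subst₂ _<_ (sym ea) (sym ec) a<c))
                          (rank< rc rb (subst₂ _<_ (sym ec) (sym eb) c<b))
                          (rank< rb rd (subst₂ _<_ (sym eb) (sym ed) b<d))
                          (trans (sym (localLabel-in-block a t refl)) (trans xab (localLabel-in-block b t (sym qab))))
                          (trans (sym (localLabel-in-block c t (sym qac))) (trans xcd (localLabel-in-block d t (trans (sym qcd) (sym qac)))))
        in proj₂ (code-kernel a c ha hc) (qac , trans (localLabel-in-block a t refl) (trans sameLocal (sym (localLabel-in-block c t (sym qac)))))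

      glued-isNCP : T (isNCP glued)
      glued-isNCP =
        isNCP⁺ glued (nonempty⁺ glued (subst (0 <_) (sym length-glued) n>0)) (standardize-isRGS code)
          (isNoncrossing⁺ glued (Noncrossing-kernel glued code (trans length-glued (sym length-code))
            (subst (λ L → SameKernel L glued code) (sym (length-stdFrom [] code)) (stdFrom-kernel [] code)) code-Noncrossing))

      Glued : NCP
      Glued = glued , glued-isNCP

      restrict-glued : ∀ t → t < k → restrictToBlock glued q t ≡ component t
      restrict-glued t h =
        isRGS-kernel-unique _ _ (standardize-isRGS (rawRestrict glued q t)) (NCP-isRGS (atN z t))
          (trans (length-restrict glued q t lgq) (sym (length-component t h)))
          (subst (λ L → SameKernel L (restrictToBlock glued q t) (component t)) (sym (length-restrict glued q t lgq)) kernel)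
        where
        lgq = trans length-glued lpq
        kernel : SameKernel (length (positions q t)) (restrictToBlock glued q t) (component t)
        kernel u v hu hv =
          let (iu< , qu) = positions-sound q t u hu
              (iv< , qv) = positions-sound q t v hv
              iu = at (positions q t) u
              iv = at (positions q t) v
              xu : localLabel iu ≡ at (component t) u
              xu = trans (localLabel-in-block iu t qu) (cong (at (component t)) (rank-positions q t u hu))
              xv : localLabel iv ≡ at (component t) v
              xv = trans (localLabel-in-block iv t qv) (cong (at (component t)) (rank-positions q t v hv))
              (to , from) = restrict-kernel glued q t lgq u v hu hv
              (to′ , from′) = glued-kernel iu iv (subst (iu <_) (sym lpq) iu<) (subst (iv <_) (sym lpq) iv<)
          in (λ e → trans (sym xu) (trans (proj₂ (to′ (to e))) xv)) ,
             (λ e → from (from′ (trans qu (sym qv) , trans xu (trans e (sym xv)))))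

      blockRestrictions-glued : blockRestrictions Glued ≡ z
      blockRestrictions-glued = begin
        map (blockRestriction Glued) (upTo k) ≡⟨ map-cong-local (All.tabulate λ {t} t∈ → sameComponent t (∈-upTo⁻ t∈)) ⟩
        map (atN z) (upTo k)                  ≡⟨ cong (λ L → map (atN z) (upTo L)) (sym length-tuple) ⟩
        map (atN z) (upTo (length z))         ≡⟨ map-atN-upTo z ⟩
        z                                     ∎
        where
        open ≡-Reasoning
        sameComponent : ∀ t → t < k → blockRestriction Glued t ≡ atN z t
        sameComponent t h = NCP-≡ (trans (blockRestriction-proj Glued t (trans length-glued lpq) h) (restrict-glued t h))

    inInterval : NCP → Bool
    inInterval M = (P ≤P M) ∧ (M ≤P Q)

    inInterval⁻ : ∀ M → T (inInterval M) → Finer p (proj₁ M) × Finer (proj₁ M) q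
    inInterval⁻ M h = let (a , b) = T-∧⁻ {P ≤P M} h in leqL⁻ p (proj₁ M) a , leqL⁻ (proj₁ M) q b

    intervalRestrictions : List (List NCP)
    intervalRestrictions = map blockRestrictions (select inInterval (NCPs n))

    intervalRestrictions-Unique : Unique intervalRestrictions
    intervalRestrictions-Unique =
      map-Unique-injectiveOn blockRestrictions (select inInterval (NCPs n)) (select-Unique inInterval (NCPs n) (NCPs-Unique n))
        (λ {x} {y} x∈ y∈ → blockRestrictions-injective x y (below x x∈) (below y y∈))
      where
      below : ∀ M → M ∈ select inInterval (NCPs n) → Finer (proj₁ M) q
      below M M∈ = proj₂ (inInterval⁻ M (proj₂ (∈-select⁻ inInterval (NCPs n) M∈)))

    blockRestrictions-bijection : intervalRestrictions ↭ upperTuples (blockRestrictions P)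
    blockRestrictions-bijection =
      ∼bag⇒↭ (unique∧set⇒bag intervalRestrictions-Unique (upperTuples-Unique (blockRestrictions P)) (mk⇔ to from))
      where
      to : ∀ {z} → z ∈ intervalRestrictions → z ∈ upperTuples (blockRestrictions P)
      to z∈ with ∈-map⁻ blockRestrictions z∈
      ... | (M , M∈ , refl) =
        let (P≤M , M≤Q) = inInterval⁻ M (proj₂ (∈-select⁻ inInterval (NCPs n) M∈)) in
        ∈-upperTuples⁺ (blockRestrictions P) (blockRestrictions M) (blockRestrictions-above M (proj₁ M≤Q) P≤M)
      from : ∀ {z} → z ∈ upperTuples (blockRestrictions P) → z ∈ intervalRestrictions
      from {z} z∈ =
        subst (_∈ intervalRestrictions) G.blockRestrictions-glued
          (∈-map⁺ blockRestrictions (∈-select⁺ inInterval (NCPs n)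
            (subst (λ s → G.Glued ∈ NCPs s) G.length-glued (∈-NCPs⁺ G.Glued))
            (T-∧⁺ (leqL⁺ p G.glued G.P≤glued) (leqL⁺ G.glued q G.glued≤Q))))
        where module G = Glue z (∈-upperTuples⁻ (blockRestrictions P) z z∈)

  rawRestrict-∷-in : ∀ a A x B s → x ≡ s → rawRestrict (a ∷ A) (x ∷ B) s ≡ a ∷ rawRestrict A B s
  rawRestrict-∷-in a A x B s e with x == s in eq
  ... | true = refl
  ... | false = ⊥-elim (subst T eq (≡→== e))

  rawRestrict-∷-out : ∀ a A x B s → x ≢ s → rawRestrict (a ∷ A) (x ∷ B) s ≡ rawRestrict A B s
  rawRestrict-∷-out a A x B s ne with x == s in eq
  ... | true = ⊥-elim (ne (==→≡ (subst T (sym eq) tt)))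
  ... | false = refl

  rawRestrict-cong : ∀ A B B′ s s′ → length A ≡ length B → length B ≡ length B′ →
    (∀ j → j < length B → (at B j ≡ s) ⇔ (at B′ j ≡ s′)) → rawRestrict A B s ≡ rawRestrict A B′ s′
  rawRestrict-cong [] [] [] s s′ _ _ _ = refl
  rawRestrict-cong (a ∷ A) (x ∷ B) (y ∷ B′) s s′ l l′ H with x ℕ.≟ s | y ℕ.≟ s′
  ... | yes e | yes e′ rewrite rawRestrict-∷-in a A x B s e | rawRestrict-∷-in a A y B′ s′ e′ = cong (a ∷_) tail
    where tail = rawRestrict-cong A B B′ s s′ (suc-injective l) (suc-injective l′) (λ j h → H (suc j) (s≤s h))
  ... | yes e | no ne′ = ⊥-elim (ne′ (proj₁ (H 0 (s≤s z≤n)) e))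
  ... | no ne | yes e′ = ⊥-elim (ne (proj₂ (H 0 (s≤s z≤n)) e′))
  ... | no ne | no ne′ rewrite rawRestrict-∷-out a A x B s ne | rawRestrict-∷-out a A y B′ s′ ne′ =
    rawRestrict-cong A B B′ s s′ (suc-injective l) (suc-injective l′) (λ j h → H (suc j) (s≤s h))

  rawRestrict-rawRestrict : ∀ p q m t s → length p ≡ length q → length m ≡ length q →
    (∀ i → i < length m → at m i ≡ s → at q i ≡ t) →
    rawRestrict (rawRestrict p q t) (rawRestrict m q t) s ≡ rawRestrict p m s
  rawRestrict-rawRestrict [] [] [] t s _ _ _ = refl
  rawRestrict-rawRestrict (a ∷ p) (y ∷ q) (x ∷ m) t s l l′ H with y ℕ.≟ t | x ℕ.≟ s
  ... | yes e | yes e′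
    rewrite rawRestrict-∷-in a p y q t e | rawRestrict-∷-in x m y q t e
          | rawRestrict-∷-in a (rawRestrict p q t) x (rawRestrict m q t) s e′ | rawRestrict-∷-in a p x m s e′ =
    cong (a ∷_) (rawRestrict-rawRestrict p q m t s (suc-injective l) (suc-injective l′) (λ i h → H (suc i) (s≤s h)))
  ... | yes e | no ne′
    rewrite rawRestrict-∷-in a p y q t e | rawRestrict-∷-in x m y q t e
          | rawRestrict-∷-out a (rawRestrict p q t) x (rawRestrict m q t) s ne′ | rawRestrict-∷-out a p x m s ne′ =
    rawRestrict-rawRestrict p q m t s (suc-injective l) (suc-injective l′) (λ i h → H (suc i) (s≤s h))
  ... | no ne | yes e′ = ⊥-elim (ne (H 0 (s≤s z≤n) e′))
  ... | no ne | no ne′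
    rewrite rawRestrict-∷-out a p y q t ne | rawRestrict-∷-out x m y q t ne | rawRestrict-∷-out a p x m s ne′ =
    rawRestrict-rawRestrict p q m t s (suc-injective l) (suc-injective l′) (λ i h → H (suc i) (s≤s h))

  ≡⇔≡ : ∀ {a a′ b b′ : ℕ} → a ≡ a′ → b ≡ b′ → (a ≡ b) ⇔ (a′ ≡ b′)
  ≡⇔≡ refl refl = (λ e → e) , (λ e → e)

  map-at-kernel : ∀ X X′ I → SameKernel (length X) X X′ → (∀ u → u < length I → at I u < length X) →
    SameKernel (length I) (map (at X) I) (map (at X′) I)
  map-at-kernel X X′ I ker bound u v hu hv =
    ⇔-trans (≡⇔≡ (at-map (at X) I u hu) (at-map (at X) I v hv))
      (⇔-trans (ker (at I u) (at I v) (bound u hu) (bound v hv))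
        (≡⇔≡ (sym (at-map (at X′) I u hu)) (sym (at-map (at X′) I v hv))))

  standardize-rawRestrict-standardize : ∀ X Y s → length X ≡ length Y →
    standardize (rawRestrict (standardize X) Y s) ≡ standardize (rawRestrict X Y s)
  standardize-rawRestrict-standardize X Y s l
    rewrite rawRestrict-positions (standardize X) Y s (trans (length-stdFrom [] X) l) | rawRestrict-positions X Y s l =
    standardize-cong (map (at (standardize X)) I) (map (at X) I) (trans (length-map (at (standardize X)) I) (sym (length-map (at X) I)))
      (subst (λ L → SameKernel L (map (at (standardize X)) I) (map (at X) I)) (sym (length-map (at (standardize X)) I))
        (map-at-kernel (standardize X) X I (subst (λ L → SameKernel L (standardize X) X) (sym (length-stdFrom [] X)) (stdFrom-kernel [] X))
          (λ u hu → subst (at I u <_) (sym (trans (length-stdFrom [] X) l)) (proj₁ (positions-sound Y s u hu)))))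
    where I = positions Y s

  quotient : NCP → NCP → List NCP
  quotient P Q = map (λ b → asNCP (restrictToBlock (proj₁ P) (proj₁ Q) b)) (upTo (nblocks (proj₁ Q)))

  quotients : List NCP → List NCP → List NCP
  quotients (R ∷ rs) (Z ∷ zs) = quotient R Z ++ quotients rs zs
  quotients _ _ = []

  quotients-map : ∀ (f g : ℕ → NCP) L → quotients (map f L) (map g L) ≡ concatMap (λ t → quotient (f t) (g t)) L
  quotients-map f g [] = refl
  quotients-map f g (t ∷ L) = cong (quotient (f t) (g t) ++_) (quotients-map f g L)

  -- For M ≤ Q the blocks of M are the blocks of the restrictions M|τ, τ ∈ Q: the block labelled s
  -- in M|τ (τ the block labelled t) is the block of M labelled `globalLabel t s`. Restricting P to
  -- it in two steps or in one gives the same partition, hence P/M = ∏_τ (P|τ)/(M|τ) up to order.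
  module QuotientFactorisation (P Q M : NCP) (P≤Q : Finer (proj₁ P) (proj₁ Q)) (M≤Q : Finer (proj₁ M) (proj₁ Q)) where
    open IntervalBlocks P Q P≤Q
    m = proj₁ M

    lm : length m ≡ length q
    lm = proj₁ M≤Q

    restrictM : ℕ → List ℕ
    restrictM t = restrictToBlock m q t

    length-restrictM : ∀ t → length (restrictM t) ≡ length (positions q t)
    length-restrictM t = length-restrict m q t lm

    firstIndex : ℕ → ℕ → ℕ
    firstIndex t s = fromMaybe 0 (indexOf s (restrictM t))

    globalLabel : ℕ → ℕ → ℕ
    globalLabel t s = at m (at (positions q t) (firstIndex t s))

    firstIndex-sound : ∀ t s → s < nblocks (restrictM t) →
      (firstIndex t s < length (restrictM t)) × (at (restrictM t) (firstIndex t s) ≡ s)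
    firstIndex-sound t s h with isRGS-labels-occur (restrictM t) (standardize-isRGS (rawRestrict m q t)) s h
    ... | (j , hj , e) with indexOf-occurs s (restrictM t) j hj e
    ... | (j₀ , e₀) rewrite e₀ = let (a , b) = indexOf-just⁻ s (restrictM t) j₀ e₀ in b , a

    representative-sound : ∀ t s → s < nblocks (restrictM t) →
      let i = at (positions q t) (firstIndex t s) in (i < length m) × (at q i ≡ t) × (firstIndex t s < length (positions q t))
    representative-sound t s h =
      let a = subst (firstIndex t s <_) (length-restrictM t) (proj₁ (firstIndex-sound t s h))
          (b , c) = positions-sound q t (firstIndex t s) a
      in subst (at (positions q t) (firstIndex t s) <_) (sym lm) b , c , a

    rawRestrict-at-firstIndex : ∀ t s → s < nblocks (restrictM t) → at (rawRestrict m q t) (firstIndex t s) ≡ globalLabel t s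
    rawRestrict-at-firstIndex t s h =
      trans (cong (λ L → at L (firstIndex t s)) (rawRestrict-positions m q t lm))
        (at-map (at m) (positions q t) (firstIndex t s) (proj₂ (proj₂ (representative-sound t s h))))

    restrict-restrict : ∀ t s → s < nblocks (restrictM t) →
      restrictToBlock (restrictToBlock p q t) (restrictM t) s ≡ restrictToBlock p m (globalLabel t s)
    restrict-restrict t s h = begin
      standardize (rawRestrict (standardize (rawRestrict p q t)) (restrictM t) s)
        ≡⟨ cong standardize
             (rawRestrict-cong (restrictToBlock p q t) (restrictM t) (rawRestrict m q t) s (globalLabel t s) lengths lsub sameBlock) ⟩
      standardize (rawRestrict (standardize (rawRestrict p q t)) (rawRestrict m q t) (globalLabel t s))
        ≡⟨ standardize-rawRestrict-standardize (rawRestrict p q t) (rawRestrict m q t) (globalLabel t s)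
             (trans (length-rawRestrict p q t lpq) (sym (length-rawRestrict m q t lm))) ⟩
      standardize (rawRestrict (rawRestrict p q t) (rawRestrict m q t) (globalLabel t s))
        ≡⟨ cong standardize (rawRestrict-rawRestrict p q m t (globalLabel t s) lpq lm inBlock) ⟩
      standardize (rawRestrict p m (globalLabel t s)) ∎
      where
      open ≡-Reasoning
      lsub : length (restrictM t) ≡ length (rawRestrict m q t)
      lsub = trans (length-restrictM t) (sym (length-rawRestrict m q t lm))
      lengths : length (restrictToBlock p q t) ≡ length (restrictM t)
      lengths = trans (length-restrict p q t lpq) (sym (length-restrictM t))
      sameBlock : ∀ j → j < length (restrictM t) → (at (restrictM t) j ≡ s) ⇔ (at (rawRestrict m q t) j ≡ globalLabel t s)
      sameBlock j hj =
        let (a , b) = firstIndex-sound t s h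
            (to , from) = stdFrom-kernel [] (rawRestrict m q t) j (firstIndex t s) (subst (j <_) lsub hj) (subst (firstIndex t s <_) lsub a)
        in (λ e → trans (to (trans e (sym b))) (rawRestrict-at-firstIndex t s h)) ,
           (λ e → trans (from (trans e (sym (rawRestrict-at-firstIndex t s h)))) b)
      inBlock : ∀ i → i < length m → at m i ≡ globalLabel t s → at q i ≡ t
      inBlock i hi e = let (a , b , _) = representative-sound t s h in trans (proj₂ M≤Q i _ hi a e) b

    globalLabel-injective : ∀ t s s′ → s < nblocks (restrictM t) → s′ < nblocks (restrictM t) →
      globalLabel t s ≡ globalLabel t s′ → s ≡ s′
    globalLabel-injective t s s′ h h′ e =
      let (a , b) = firstIndex-sound t s h
          (a′ , b′) = firstIndex-sound t s′ h′
          ker = restrict-kernel m q t lm (firstIndex t s) (firstIndex t s′)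
                  (subst (firstIndex t s <_) (length-restrictM t) a) (subst (firstIndex t s′ <_) (length-restrictM t) a′)
      in trans (sym b) (trans (proj₂ ker e) b′)

    globalLabel-block : ∀ t t′ s s′ → s < nblocks (restrictM t) → s′ < nblocks (restrictM t′) →
      globalLabel t s ≡ globalLabel t′ s′ → t ≡ t′
    globalLabel-block t t′ s s′ h h′ e =
      let (a , b , _) = representative-sound t s h
          (a′ , b′ , _) = representative-sound t′ s′ h′
      in trans (sym b) (trans (proj₂ M≤Q _ _ a a′ e) b′)

    globalLabels : List ℕ
    globalLabels = concatMap (λ t → map (globalLabel t) (upTo (nblocks (restrictM t)))) (upTo k)

    globalLabels-Unique : Unique globalLabels
    globalLabels-Unique = concatMap-Unique (λ t → map (globalLabel t) (upTo (nblocks (restrictM t)))) (upTo k) (upTo⁺ k)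
      (λ t _ → map-Unique-injectiveOn (globalLabel t) (upTo (nblocks (restrictM t))) (upTo⁺ (nblocks (restrictM t)))
                 (λ {x} {y} mx my e → globalLabel-injective t x y (∈-upTo⁻ mx) (∈-upTo⁻ my) e))
      (λ {t} {t′} _ _ z₁ z₂ → let (s , ms , e) = ∈-map⁻ (globalLabel t) z₁
                                  (s′ , ms′ , e′) = ∈-map⁻ (globalLabel t′) z₂
                              in globalLabel-block t t′ s s′ (∈-upTo⁻ ms) (∈-upTo⁻ ms′) (trans (sym e) e′))

    globalLabel-surjective : ∀ {s} → s ∈ upTo (nblocks m) → s ∈ globalLabels
    globalLabel-surjective {s} ms with isRGS-labels-occur m (NCP-isRGS M) s (∈-upTo⁻ ms)
    ... | (i , hi , e) =
      ∈-concatMap⁺ (λ t → map (globalLabel t) (upTo (nblocks (restrictM t))))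
        (Any.map (λ { refl → subst (_∈ map (globalLabel t) (upTo (nblocks (restrictM t)))) label≡s
                                 (∈-map⁺ (globalLabel t) (∈-upTo⁺ hs′)) }) (∈-upTo⁺ (at<nblocks q i hiq)))
      where
      hiq = subst (i <_) lm hi
      t = at q i
      j = rank q i
      rj = proj₁ (rank-sound q i hiq)
      hj = subst (j <_) (sym (length-restrictM t)) rj
      s′ = at (restrictM t) j
      hs′ = at<nblocks (restrictM t) j hj
      label≡s : globalLabel t s′ ≡ s
      label≡s =
        let (a₀ , b₀) = firstIndex-sound t s′ hs′ in
        trans (proj₁ (restrict-kernel m q t lm (firstIndex t s′) j (subst (firstIndex t s′ <_) (length-restrictM t) a₀) rj) b₀)
          (trans (cong (at m) (proj₂ (rank-sound q i hiq))) e)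

    globalLabels-permutation : upTo (nblocks m) ↭ globalLabels
    globalLabels-permutation = ∼bag⇒↭ (unique∧set⇒bag (upTo⁺ (nblocks m)) globalLabels-Unique (mk⇔ globalLabel-surjective into))
      where
      into : ∀ {s} → s ∈ globalLabels → s ∈ upTo (nblocks m)
      into ms with find (∈-concatMap⁻ (λ t → map (globalLabel t) (upTo (nblocks (restrictM t)))) {xs = upTo k} ms)
      ... | (t , _ , mz) with ∈-map⁻ (globalLabel t) mz
      ...   | (s′ , ms′ , refl) = ∈-upTo⁺ (at<nblocks m _ (proj₁ (representative-sound t s′ (∈-upTo⁻ ms′))))

    restrictionOf : ℕ → NCP
    restrictionOf s = asNCP (restrictToBlock p m s)

    quotient-blockRestriction : ∀ t → t < k →
      quotient (blockRestriction P t) (blockRestriction M t) ≡ map restrictionOf (map (globalLabel t) (upTo (nblocks (restrictM t))))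
    quotient-blockRestriction t h =
      trans (cong₂ (λ X Y → map (λ b → asNCP (restrictToBlock X Y b)) (upTo (nblocks Y)))
              (blockRestriction-proj P t lpq h) (blockRestriction-proj M t lm h))
        (trans (map-cong-local (All.tabulate (λ {s} ms → cong asNCP (restrict-restrict t s (∈-upTo⁻ ms)))))
          (map-∘ (upTo (nblocks (restrictM t)))))

    quotient-factorises : quotient P M ↭ quotients (blockRestrictions P) (blockRestrictions M)
    quotient-factorises = subst (quotient P M ↭_) (sym factorisation) (↭.map⁺ restrictionOf globalLabels-permutation)
      where
      factorisation : quotients (blockRestrictions P) (blockRestrictions M) ≡ map restrictionOf globalLabels
      factorisation = trans (quotients-map (blockRestriction P) (blockRestriction M) (upTo k))
        (trans (cong concat (map-cong-local (All.tabulate (λ {t} mt → quotient-blockRestriction t (∈-upTo⁻ mt)))))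
          (sym (map-concatMap restrictionOf (λ t → map (globalLabel t) (upTo (nblocks (restrictM t)))) (upTo k))))

  nblocks-all-zero : ∀ l → (∀ u → u < length l → at l u ≡ 0) → nblocks l ≤ 1
  nblocks-all-zero [] _ = z≤n
  nblocks-all-zero (x ∷ l) h rewrite h 0 (s≤s z≤n) = ⊔-lub ≤-refl (nblocks-all-zero l (λ u hu → h (suc u) (s≤s hu)))

  nblocks≡1⁺ : ∀ r → T (isRGS r) → T (nonempty r) → (∀ u → u < length r → at r u ≡ at r 0) → nblocks r ≡ 1
  nblocks≡1⁺ (x ∷ r) rg _ h with ≤ᵇ⇒≤ x 0 (proj₁ (T-∧⁻ {x ≤ᵇ 0} rg))
  ... | z≤n = ≤-antisym (nblocks-all-zero (0 ∷ r) h) (m≤m⊔n 1 (nblocks r))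

  nblocks≡1⁻ : ∀ r → nblocks r ≡ 1 → ∀ u → u < length r → at r u ≡ 0
  nblocks≡1⁻ r e u h with at<nblocks r u h
  ... | lt = n<1⇒n≡0 (subst (at r u <_) e lt)

  module Counit (P Q : NCP) (P≤Q : Finer (proj₁ P) (proj₁ Q)) where
    open IntervalBlocks P Q P≤Q

    restriction∈quotient : ∀ t → t < k → blockRestriction P t ∈ quotient P Q
    restriction∈quotient t h = ∈-map⁺ (blockRestriction P) (∈-upTo⁺ h)

    quotient-self-single-blocks : P ≡ Q → ∀ R → R ∈ quotient P Q → nblocks (proj₁ R) ≡ 1
    quotient-self-single-blocks refl R R∈ with ∈-map⁻ (blockRestriction P) R∈
    ... | (t , t∈ , refl) =
      subst (λ z → nblocks z ≡ 1) (sym (asNCP-proj r isN))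
        (nblocks≡1⁺ r (standardize-isRGS (rawRestrict p q t)) (NCP-nonempty (r , isN)) λ u hu →
          let hu′ = subst (u <_) (length-restrict p q t lpq) hu
              h₀ = subst (0 <_) (length-restrict p q t lpq) (≤-<-trans z≤n hu)
          in proj₂ (restrict-kernel p q t lpq u 0 hu′ h₀)
               (trans (proj₂ (positions-sound q t u hu′)) (sym (proj₂ (positions-sound q t 0 h₀)))))
      where
      r = restrictToBlock p q t
      isN = restriction-isNCP P t lpq (∈-upTo⁻ t∈)

    quotient-multi-block : ∀ i j → i < length q → j < length q → at q i ≡ at q j → at p i ≢ at p j →
      Σ NCP λ R → (R ∈ quotient P Q) × (nblocks (proj₁ R) ≢ 1)
    quotient-multi-block i j hi hj qij pij = blockRestriction P t , restriction∈quotient t (at<nblocks q i hi) , notSingle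
      where
      t = at q i
      r = restrictToBlock p q t
      isN = restriction-isNCP P t lpq (at<nblocks q i hi)
      ri = proj₁ (rank-sound q i hi)
      rj = subst (λ z → rank q j < length (positions q z)) (sym qij) (proj₁ (rank-sound q j hj))
      ej = subst (λ z → at (positions q z) (rank q j) ≡ j) (sym qij) (proj₂ (rank-sound q j hj))
      notSingle : nblocks (proj₁ (blockRestriction P t)) ≢ 1
      notSingle e =
        let e′ = trans (sym (cong nblocks (asNCP-proj r isN))) e
            ri′ = subst (rank q i <_) (sym (length-restrict p q t lpq)) ri
            rj′ = subst (rank q j <_) (sym (length-restrict p q t lpq)) rj
        in pij (subst₂ (λ x y → at p x ≡ at p y) (proj₂ (rank-sound q i hi)) ej
             (proj₁ (restrict-kernel p q t lpq (rank q i) (rank q j) ri rj)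
               (trans (nblocks≡1⁻ r e′ (rank q i) ri′) (sym (nblocks≡1⁻ r e′ (rank q j) rj′)))))

    quotient-not-single-block : ¬ T (P =P Q) → Σ NCP λ R → (R ∈ quotient P Q) × (nblocks (proj₁ R) ≢ 1)
    quotient-not-single-block P≠Q with T? (leqL q p)
    ... | yes Q≤P = ⊥-elim (P≠Q (≡→=P P Q (NCP-≡ (isRGS-kernel-unique p q (NCP-isRGS P) (NCP-isRGS Q) lpq
                      (λ i j hi hj → proj₂ P≤Q i j hi hj , proj₂ (leqL⁻ q p Q≤P) i j (subst (i <_) lpq hi) (subst (j <_) lpq hj))))))
    ... | no Q≰P with all-false _ (upTo (length q)) (λ t → Q≰P (T-∧⁺ (≡→== (sym lpq)) t))
    ... | (i , i∈ , hi) with all-false _ (upTo (length q)) hi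
    ... | (j , j∈ , hj) = quotient-multi-block i j (∈-upTo⁻ i∈) (∈-upTo⁻ j∈) qij pij
      where
      qij : at q i ≡ at q j
      qij with at q i ≟ at q j
      ... | yes e = e
      ... | no ne = ⊥-elim (hj (T-∨⁺ˡ (T-not⁺ (λ x → ne (==→≡ x)))))
      pij : at p i ≢ at p j
      pij e = hj (T-∨⁺ʳ {not (at q i == at q j)} (≡→== e))

module Coalgebra {c ℓ : Level} (K : CommutativeRing c ℓ) where
  open Partitions
  open FreeModule K
  open CommutativeRing K
    using (Carrier; _≈_; _+_; _*_; 0#; 1#; +-identityˡ; +-identityʳ; *-identityˡ; zeroʳ; zeroˡ; distribˡ;
           +-cong; *-cong; +-assoc; +-comm; *-assoc; reflexive)
    renaming (refl to ≈refl; sym to ≈sym; trans to ≈trans)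

  scale : ∀ {B : Set} → Carrier → Carrier × B → Carrier × B
  scale a (x , b) = (a * x , b)

  coeff-++ : ∀ {B : Set} (eq : B → B → Bool) (v w : LC B) b → coeff eq (v ++ w) b ≈ coeff eq v b + coeff eq w b
  coeff-++ eq [] w b = ≈sym (+-identityˡ _)
  coeff-++ eq ((x , e) ∷ v) w b with eq b e
  ... | true = ≈trans (+-cong ≈refl (coeff-++ eq v w b)) (≈sym (+-assoc _ _ _))
  ... | false = coeff-++ eq v w b

  coeff-scale : ∀ {B : Set} (eq : B → B → Bool) a (w : LC B) b → coeff eq (map (scale a) w) b ≈ a * coeff eq w b
  coeff-scale eq a [] b = ≈sym (zeroʳ a)
  coeff-scale eq a ((x , e) ∷ w) b with eq b e
  ... | true = ≈trans (+-cong ≈refl (coeff-scale eq a w b)) (≈sym (distribˡ a x _))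
  ... | false = coeff-scale eq a w b

  coeff-lin : ∀ {B B′ : Set} (eq : B′ → B′ → Bool) (f : B → LC B′) (v : LC B) b →
    coeff eq (lin f v) b ≈ linK (λ y → coeff eq (f y) b) v
  coeff-lin eq f [] b = ≈refl
  coeff-lin eq f ((a , y) ∷ v) b =
    ≈trans (coeff-++ eq (map (scale a) (f y)) (lin f v) b) (+-cong (coeff-scale eq a (f y) b) (coeff-lin eq f v b))

  linK-cong : ∀ {B : Set} (f g : B → Carrier) (v : LC B) → (∀ y → f y ≈ g y) → linK f v ≈ linK g v
  linK-cong f g [] h = ≈refl
  linK-cong f g ((a , y) ∷ v) h = +-cong (*-cong ≈refl (h y)) (linK-cong f g v h)

  linK-++ : ∀ {B : Set} (f : B → Carrier) (v w : LC B) → linK f (v ++ w) ≈ linK f v + linK f w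
  linK-++ f [] w = ≈sym (+-identityˡ _)
  linK-++ f ((a , y) ∷ v) w = ≈trans (+-cong ≈refl (linK-++ f v w)) (≈sym (+-assoc _ _ _))

  linK-scale : ∀ {B : Set} (f : B → Carrier) a (w : LC B) → linK f (map (scale a) w) ≈ a * linK f w
  linK-scale f a [] = ≈sym (zeroʳ a)
  linK-scale f a ((d , y) ∷ w) = ≈trans (+-cong (*-assoc a d (f y)) (linK-scale f a w)) (≈sym (distribˡ a _ _))

  linK-lin : ∀ {B B′ : Set} (h : B′ → Carrier) (f : B → LC B′) (v : LC B) → linK h (lin f v) ≈ linK (λ y → linK h (f y)) v
  linK-lin h f [] = ≈refl
  linK-lin h f ((a , y) ∷ v) =
    ≈trans (linK-++ h (map (scale a) (f y)) (lin f v)) (+-cong (linK-scale h a (f y)) (linK-lin h f v))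

  coeff-lin-lin : ∀ {B B′ B″ : Set} (eq : B″ → B″ → Bool) (g : B′ → LC B″) (f : B → LC B′) (v : LC B) b →
    coeff eq (lin g (lin f v)) b ≈ linK (λ y → coeff eq (lin g (f y)) b) v
  coeff-lin-lin eq g f v b = ≈trans (coeff-lin eq g (lin f v) b)
    (≈trans (linK-lin (λ y → coeff eq (g y) b) f v)
      (linK-cong _ _ v (λ y → ≈sym (coeff-lin eq g (f y) b))))

  formalSum : ∀ {B : Set} → List B → LC B
  formalSum = map (1# ,_)

  Ones : ∀ {B : Set} → LC B → List B → Set ℓ
  Ones [] [] = Lift ℓ ⊤
  Ones ((a , x) ∷ v) (y ∷ l) = (a ≈ 1#) × (x ≡ y) × Ones v l
  Ones _ _ = Lift ℓ ⊥

  coeff-Ones : ∀ {B : Set} (eq : B → B → Bool) (v : LC B) l b → Ones v l → coeff eq v b ≈ coeff eq (formalSum l) b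
  coeff-Ones eq [] [] b _ = ≈refl
  coeff-Ones eq ((a , x) ∷ v) (y ∷ l) b (a≈1 , refl , u) with eq b x
  ... | true = +-cong a≈1 (coeff-Ones eq v l b u)
  ... | false = coeff-Ones eq v l b u

  Ones-++ : ∀ {B : Set} (v w : LC B) l l′ → Ones v l → Ones w l′ → Ones (v ++ w) (l ++ l′)
  Ones-++ [] w [] l′ _ u = u
  Ones-++ ((a , x) ∷ v) w (y ∷ l) l′ (a≈1 , e , u) u′ = a≈1 , e , Ones-++ v w l l′ u u′

  Ones-concatMap : ∀ {A B : Set} (f : A → LC B) (g : A → List B) L → (∀ x → Ones (f x) (g x)) →
    Ones (concatMap f L) (concatMap g L)
  Ones-concatMap f g [] h = lift tt
  Ones-concatMap f g (x ∷ L) h = Ones-++ (f x) (concatMap f L) (g x) (concatMap g L) (h x) (Ones-concatMap f g L h)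

  Ones-scale : ∀ {B : Set} a (w : LC B) l → a ≈ 1# → Ones w l → Ones (map (scale a) w) l
  Ones-scale a [] [] _ u = lift tt
  Ones-scale a ((d , x) ∷ w) (y ∷ l) a≈1 (d≈1 , e , u) = ≈trans (*-cong a≈1 d≈1) (*-identityˡ 1#) , e , Ones-scale a w l a≈1 u

  Ones-select : ∀ {A B : Set} (c : A → Bool) (g : A → B) L →
    Ones (concatMap (λ x → if c x then [ (1# , g x) ] else []) L) (map g (select c L))
  Ones-select c g [] = lift tt
  Ones-select c g (x ∷ L) with c x
  ... | true = ≈refl , refl , Ones-select c g L
  ... | false = Ones-select c g L

  mulBasis : List Mon² → List Mon² → List Mon²
  mulBasis a c = concatMap (λ x → map (λ y → (proj₁ x ++ proj₁ y , proj₂ x ++ proj₂ y)) c) a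

  Ones-mul : ∀ (v w : A⊗A) a c → Ones v a → Ones w c → Ones (mul⊗ v w) (mulBasis a c)
  Ones-mul [] w [] c _ _ = lift tt
  Ones-mul ((d , x) ∷ v) w (x′ ∷ a) c (d≈1 , refl , u) uw =
    Ones-++ _ (mul⊗ v w) _ (mulBasis a c) (row w c uw) (Ones-mul v w a c u uw)
    where
    row : ∀ w c → Ones w c → Ones (map (λ y → (d * proj₁ y , (proj₁ x ++ proj₁ (proj₂ y) , proj₂ x ++ proj₂ (proj₂ y)))) w)
                                  (map (λ y → (proj₁ x ++ proj₁ y , proj₂ x ++ proj₂ y)) c)
    row [] [] _ = lift tt
    row ((e , y) ∷ w) (y′ ∷ c) (e≈1 , refl , u′) = ≈trans (*-cong d≈1 e≈1) (*-identityˡ 1#) , refl , row w c u′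

  coeff-↭ : ∀ {B : Set} (eq : B → B → Bool) {v w : LC B} b → v ↭ w → coeff eq v b ≈ coeff eq w b
  coeff-↭ eq b ↭.refl = ≈refl
  coeff-↭ eq b (↭.prep (a , x) p) with eq b x
  ... | true = +-cong ≈refl (coeff-↭ eq b p)
  ... | false = coeff-↭ eq b p
  coeff-↭ eq b (↭.swap (a , x) (a′ , x′) p) with eq b x | eq b x′
  ... | true | true = ≈trans (≈sym (+-assoc _ _ _)) (≈trans (+-cong (+-comm a a′) (coeff-↭ eq b p)) (+-assoc _ _ _))
  ... | true | false = +-cong ≈refl (coeff-↭ eq b p)
  ... | false | true = +-cong ≈refl (coeff-↭ eq b p)
  ... | false | false = coeff-↭ eq b p
  coeff-↭ eq b (↭.trans p p′) = ≈trans (coeff-↭ eq b p) (coeff-↭ eq b p′)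

  coeff-formalSum-cong : ∀ {A B : Set} (eq : B → B → Bool) (h₁ h₂ : A → B) L b →
    (∀ x → x ∈ L → eq b (h₁ x) ≡ eq b (h₂ x)) → coeff eq (formalSum (map h₁ L)) b ≡ coeff eq (formalSum (map h₂ L)) b
  coeff-formalSum-cong eq h₁ h₂ [] b H = refl
  coeff-formalSum-cong eq h₁ h₂ (x ∷ L) b H
    rewrite H x (here refl) | coeff-formalSum-cong eq h₁ h₂ L b (λ y m → H y (there m)) = refl

  _≟NCP_ : DecidableEquality NCP
  X ≟NCP Y with T? (X =P Y)
  ... | yes h = yes (=P→≡ X Y h)
  ... | no h = no (λ e → h (≡→=P X Y e))

  open DecMembership _≟NCP_ using (_∈?_)

  count-↭ : ∀ X {l l′} → l ↭ l′ → count X l ≡ count X l′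
  count-↭ X ↭.refl = refl
  count-↭ X (↭.prep Y p) rewrite count-↭ X p = refl
  count-↭ X (↭.swap Y Y′ p) with X =P Y | X =P Y′
  ... | true | true = cong (λ z → suc (suc z)) (count-↭ X p)
  ... | true | false = cong suc (count-↭ X p)
  ... | false | true = cong suc (count-↭ X p)
  ... | false | false = count-↭ X p
  count-↭ X (↭.trans p p′) = trans (count-↭ X p) (count-↭ X p′)

  count-∉ : ∀ X l → ¬ (X ∈ l) → count X l ≡ 0
  count-∉ X [] _ = refl
  count-∉ X (Y ∷ l) X∉ with X =P Y in e
  ... | true = ⊥-elim (X∉ (here (=P→≡ X Y (subst T (sym e) tt))))
  ... | false = count-∉ X l (λ m → X∉ (there m))

  =M⁻ : ∀ m m′ → T (m =M m′) → ∀ X → count X m ≡ count X m′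
  =M⁻ m m′ h X with X ∈? (m ++ m′)
  ... | yes X∈ = ==→≡ (T-all⁻ (λ P → count P m == count P m′) h X∈)
  ... | no X∉ = trans (count-∉ X m (λ x → X∉ (∈-++⁺ˡ x))) (sym (count-∉ X m′ (λ x → X∉ (∈-++⁺ʳ m x))))

  =M⁺ : ∀ m m′ → (∀ X → count X m ≡ count X m′) → T (m =M m′)
  =M⁺ m m′ h = T-all⁺ _ (m ++ m′) (λ {X} _ → ≡→== (h X))

  =M-resp-↭ : ∀ m {m′ m″} → m′ ↭ m″ → (m =M m′) ≡ (m =M m″)
  =M-resp-↭ m {m′} {m″} p = T-injective
    (λ h → =M⁺ m m″ (λ X → trans (=M⁻ m m′ h X) (count-↭ X p)))
    (λ h → =M⁺ m m′ (λ X → trans (=M⁻ m m″ h X) (sym (count-↭ X p))))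

  mkInterval-yes : ∀ A B (h : T (A ≤P B)) → mkInterval A B ≡ just ⟦ A , B ⟧⟨ h ⟩
  mkInterval-yes A B h with T? (A ≤P B)
  ... | yes h′ = cong (λ z → just ⟦ A , B ⟧⟨ z ⟩) (T-irrelevant h′ h)
  ... | no ¬h = ⊥-elim (¬h h)

  mkInterval-no : ∀ A B → ¬ T (A ≤P B) → mkInterval A B ≡ nothing
  mkInterval-no A B ¬h with T? (A ≤P B)
  ... | yes h = ⊥-elim (¬h h)
  ... | no _ = refl

  Φ⊗Φ-basis : Interval² → A⊗A
  Φ⊗Φ-basis (I , J) = basis (quot (Interval.lo I) (Interval.hi I) , quot (Interval.lo J) (Interval.hi J))

  between : NCP → NCP → NCP → Bool
  between P Q M = (P ≤P M) ∧ (M ≤P Q)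

  lhsTerm : NCP → NCP → NCP → Mon²
  lhsTerm P Q M = (quot M Q , quot P M)

  intervalPair : Maybe Interval → Maybe Interval → LC Interval²
  intervalPair (just I) (just J) = basis (I , J)
  intervalPair _ _ = []

  δlatTerm-intervalPair : ∀ P Q M → δlatTerm P Q M ≡ intervalPair (mkInterval M Q) (mkInterval P M)
  δlatTerm-intervalPair P Q M with mkInterval M Q | mkInterval P M
  ... | just I | just J = refl
  ... | just I | nothing = refl
  ... | nothing | just J = refl
  ... | nothing | nothing = refl

  transport : ∀ P Q M {w b} → δlatTerm P Q M ≡ w → between P Q M ≡ b →
    Ones (lin Φ⊗Φ-basis w) (if b then [ lhsTerm P Q M ] else []) →
    Ones (lin Φ⊗Φ-basis (δlatTerm P Q M)) (if between P Q M then [ lhsTerm P Q M ] else [])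
  transport P Q M refl refl o = o

  intervalPair-nothing : ∀ x → intervalPair x nothing ≡ []
  intervalPair-nothing (just _) = refl
  intervalPair-nothing nothing = refl

  -- The case split is on decisions passed as arguments: a `with` on T? (M ≤P Q) would also
  -- abstract the occurrence hidden inside mkInterval.
  Φ⊗Φ-δlatTerm : ∀ P Q M → Ones (lin Φ⊗Φ-basis (δlatTerm P Q M)) (if between P Q M then [ lhsTerm P Q M ] else [])
  Φ⊗Φ-δlatTerm P Q M = byCases (T? (P ≤P M)) (T? (M ≤P Q))
    where
    byCases : Dec (T (P ≤P M)) → Dec (T (M ≤P Q)) →
      Ones (lin Φ⊗Φ-basis (δlatTerm P Q M)) (if between P Q M then [ lhsTerm P Q M ] else [])
    byCases (yes P≤M) (yes M≤Q) = transport P Q M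
      (trans (δlatTerm-intervalPair P Q M) (cong₂ intervalPair (mkInterval-yes M Q M≤Q) (mkInterval-yes P M P≤M)))
      (cong₂ _∧_ (T→true P≤M) (T→true M≤Q)) (*-identityˡ _ , refl , lift tt)
    byCases (no P≰M) _ = transport P Q M
      (trans (δlatTerm-intervalPair P Q M)
        (trans (cong (intervalPair (mkInterval M Q)) (mkInterval-no P M P≰M)) (intervalPair-nothing (mkInterval M Q))))
      (cong (_∧ (M ≤P Q)) (¬T→false P≰M)) (lift tt)
    byCases (yes P≤M) (no M≰Q) = transport P Q M
      (trans (δlatTerm-intervalPair P Q M) (cong (λ x → intervalPair x (mkInterval P M)) (mkInterval-no M Q M≰Q)))
      (cong₂ _∧_ (T→true P≤M) (¬T→false M≰Q)) (lift tt)

  Φ⊗Φ-δlatBasis : ∀ P Q (h : T (P ≤P Q)) →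
    Ones (lin Φ⊗Φ-basis (δlatBasis ⟦ P , Q ⟧⟨ h ⟩)) (map (lhsTerm P Q) (select (between P Q) (NCPs (size P))))
  Φ⊗Φ-δlatBasis P Q h =
    subst (Ones (lin Φ⊗Φ-basis (δlatBasis ⟦ P , Q ⟧⟨ h ⟩))) (concatMap-if (between P Q) (lhsTerm P Q) (NCPs (size P)))
      (subst (λ v → Ones v (concatMap (λ M → if between P Q M then [ lhsTerm P Q M ] else []) (NCPs (size P))))
        (sym (concatMap-concatMap _ (δlatTerm P Q) (NCPs (size P))))
        (Ones-concatMap (λ M → lin Φ⊗Φ-basis (δlatTerm P Q M)) (λ M → if between P Q M then [ lhsTerm P Q M ] else [])
          (NCPs (size P)) (Φ⊗Φ-δlatTerm P Q)))

  δgenTerm : NCP → NCP → Mon²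
  δgenTerm R Z = ([ Z ] , quot R Z)

  rhsTerm : List NCP → List NCP → Mon²
  rhsTerm rs zs = (zs , quotients rs zs)

  mulBasis-δgen : ∀ R rs S zss → mulBasis (map (δgenTerm R) S) (map (rhsTerm rs) zss) ≡ map (rhsTerm (R ∷ rs)) (consAll S zss)
  mulBasis-δgen R rs [] zss = refl
  mulBasis-δgen R rs (Z ∷ S) zss =
    trans (cong₂ _++_ (trans (sym (map-∘ zss)) (map-∘ zss)) (mulBasis-δgen R rs S zss))
      (sym (map-++ (rhsTerm (R ∷ rs)) (map (Z ∷_) zss) (consAll S zss)))

  δmon-Ones : ∀ rs → Ones (δmon rs) (map (rhsTerm rs) (upperTuples rs))
  δmon-Ones [] = ≈refl , refl , lift tt
  δmon-Ones (R ∷ rs) = subst (Ones (δmon (R ∷ rs))) (mulBasis-δgen R rs S (upperTuples rs))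
    (Ones-mul (δgen R) (δmon rs) (map (δgenTerm R) S) (map (rhsTerm rs) (upperTuples rs))
      (Ones-select (R ≤P_) (δgenTerm R) (NCPs (size R))) (δmon-Ones rs))
    where S = select (R ≤P_) (NCPs (size R))

  δA-basis-Ones : ∀ m → Ones (lin δmon (basis m)) (map (rhsTerm m) (upperTuples m))
  δA-basis-Ones m = subst (Ones (lin δmon (basis m))) (++-identityʳ _)
    (Ones-++ (map (scale 1#) (δmon m)) [] (map (rhsTerm m) (upperTuples m)) []
      (Ones-scale 1# (δmon m) _ ≈refl (δmon-Ones m)) (lift tt))

  -- Both sides are sums of unit terms; the interval bijection matches them up to a permutation
  -- and the factorisation of P/M matches the second tensor factors up to reordering.
  Φ-δ-basis : ∀ P Q (h : T (P ≤P Q)) b →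
    coeff _=M²_ (lin Φ⊗Φ-basis (δlatBasis ⟦ P , Q ⟧⟨ h ⟩)) b ≈ coeff _=M²_ (lin δmon (basis (quot P Q))) b
  Φ-δ-basis P Q h b =
    ≈trans (coeff-Ones _=M²_ _ _ b (Φ⊗Φ-δlatBasis P Q h))
      (≈trans (reflexive (trans (coeff-formalSum-cong _=M²_ (lhsTerm P Q) (rhsTerm (blockRestrictions P) ∘ blockRestrictions) S b sameTerm)
                                (cong (λ l → coeff _=M²_ (formalSum l) b) (map-∘ S))))
        (≈trans (coeff-↭ _=M²_ b (↭.map⁺ (1# ,_) (↭.map⁺ (rhsTerm (blockRestrictions P)) blockRestrictions-bijection)))
          (≈sym (coeff-Ones _=M²_ _ _ b (δA-basis-Ones (quot P Q))))))
    where
    P≤Q = leqL⁻ (proj₁ P) (proj₁ Q) h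
    open IntervalBlocks P Q P≤Q
    S = select inInterval (NCPs n)
    sameTerm : ∀ M → M ∈ S → (b =M² lhsTerm P Q M) ≡ (b =M² rhsTerm (blockRestrictions P) (blockRestrictions M))
    sameTerm M M∈ = cong ((proj₁ b =M quot M Q) ∧_) (=M-resp-↭ (proj₂ b) (QuotientFactorisation.quotient-factorises P Q M P≤Q M≤Q))
      where M≤Q = proj₂ (inInterval⁻ M (proj₂ (∈-select⁻ inInterval (NCPs n) M∈)))

  εmon-single-blocks : ∀ rs → (∀ R → R ∈ rs → nblocks (proj₁ R) ≡ 1) → εmon rs ≈ 1#
  εmon-single-blocks [] H = ≈refl
  εmon-single-blocks (R ∷ rs) H rewrite H R (here refl) =
    ≈trans (*-identityˡ _) (εmon-single-blocks rs (λ R′ m → H R′ (there m)))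

  εmon-multi-block : ∀ rs R → R ∈ rs → nblocks (proj₁ R) ≢ 1 → εmon rs ≈ 0#
  εmon-multi-block (R′ ∷ rs) R (here refl) ne rewrite ¬T→false {nblocks (proj₁ R) == 1} (λ t → ne (==→≡ t)) = zeroˡ _
  εmon-multi-block (R′ ∷ rs) R (there m) ne = ≈trans (*-cong ≈refl (εmon-multi-block rs R m ne)) (zeroʳ _)

  Φ-ε-basis : ∀ P Q (h : T (P ≤P Q)) → linK εmon (basis (quot P Q)) ≈ εlatBasis ⟦ P , Q ⟧⟨ h ⟩
  Φ-ε-basis P Q h with T? (P =P Q)
  ... | yes P≡Q rewrite T→true P≡Q =
    ≈trans (+-identityʳ _) (≈trans (*-identityˡ _)
      (εmon-single-blocks (quot P Q) (Counit.quotient-self-single-blocks P Q P≤Q (=P→≡ P Q P≡Q))))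
    where P≤Q = leqL⁻ (proj₁ P) (proj₁ Q) h
  ... | no P≢Q rewrite ¬T→false P≢Q =
    let (R , R∈ , R≢1) = Counit.quotient-not-single-block P Q P≤Q P≢Q in
    ≈trans (+-identityʳ _) (≈trans (*-identityˡ _) (εmon-multi-block (quot P Q) R R∈ R≢1))
    where P≤Q = leqL⁻ (proj₁ P) (proj₁ Q) h

  Φ-basis : Interval → A
  Φ-basis I = basis (quot (Interval.lo I) (Interval.hi I))

  Φ-δ : ∀ (x : Clat) → Φ⊗Φ (δlat x) ≈A⊗A δA (Φ x)
  Φ-δ x b = ≈trans (coeff-lin-lin _=M²_ Φ⊗Φ-basis δlatBasis x b)
    (≈trans (linK-cong _ _ x (λ { ⟦ P , Q ⟧⟨ h ⟩ → Φ-δ-basis P Q h b }))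
      (≈sym (coeff-lin-lin _=M²_ δmon Φ-basis x b)))

  Φ-ε : ∀ (x : Clat) → εA (Φ x) ≈ εlat x
  Φ-ε x = ≈trans (linK-lin εmon Φ-basis x) (linK-cong _ _ x (λ { ⟦ P , Q ⟧⟨ h ⟩ → Φ-ε-basis P Q h }))

mainTheorem12 : {c ℓ : Level} (K : CommutativeRing c ℓ) → IsFieldChar0 K →
    FreeModule.IsCoalgebraHom K
mainTheorem12 K _ = Φ-δ , Φ-ε
  where open Coalgebra K
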